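{- For $n\ge 1$ let $A_n(x,y,q)=\sum_{\pi\in\mathfrak{S}_n}x^{\mathrm{exc}(\pi)}y^{\mathrm{fix}(\pi)}q^{\mathrm{cyc}(\pi)}$ and $A(x,y,q;z)=1+\sum_{n\ge1}A_n(x,y,q)\frac{z^n}{n!}$. For $n\ge 0$ let $\widetilde{A}_n(x,y,q,p)=\sum_{\sigma\in\widehat{\mathcal{Q}}_{n+1}}x^{\mathrm{exc}(\sigma)}y^{\mathrm{fix}(\sigma)}q^{\mathrm{cyc}(\sigma)}p^{\mathrm{fcyc}(\sigma)}$ and $\widetilde{A}(x,y,q,p;z)=\sum_{n\ge0}\widetilde{A}_n(x,y,q,p)\frac{z^n}{n!}$. Then, as formal power series in $z$, $$\widetilde{A}(x,y,q,p;z)=\left(e^{xpz}+y-1\right)pq\,A(x,y,q;z).$$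
   Context: For $\sigma\in\mathfrak{S}_m$: $\mathrm{exc}(\sigma)=|\{i:\sigma(i)>i\}|$, $\mathrm{fix}(\sigma)=|\{i:\sigma(i)=i\}|$, $\mathrm{cyc}(\sigma)$ is the number of cycles. $\widehat{\mathcal{Q}}_m$ is the set of $\sigma\in\mathfrak{S}_m$ whose cycle containing $m$, written as $(c_1,\dots,c_k,m)$ ending with $m$ (i.e. $\sigma(c_i)=c_{i+1}$, $\sigma(c_k)=m$, $\sigma(m)=c_1$), satisfies $c_1<c_2<\cdots<c_k$ (possibly $k=0$, i.e. $m$ is a fixed point); $\mathrm{fcyc}(\sigma)$ is the number of elements of the cycle containing $m$. -}

module Defs where

open import Level using (Level)
open import Data.Nat using (ℕ; zero; suc; _≡ᵇ_; _<ᵇ_; _≤ᵇ_; _∸_)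
open import Data.Nat.Combinatorics using (_C_)
open import Data.Bool using (Bool; true; false; _∧_; _∨_; not; if_then_else_)
open import Data.Fin using (Fin; toℕ; fromℕ)
open import Data.List using (List; []; _∷_; [_]; map; concatMap; allFin; upTo; foldr)
import Data.Vec.Functional as VF
open import Algebra.Bundles using (CommutativeRing)

allFuns : (m n : ℕ) → List (Fin m → Fin n)
allFuns zero    n = [ (λ ()) ]
allFuns (suc m) n = concatMap (λ f → map (λ a → a VF.∷ f) (allFin n)) (allFuns m n)

allB : {A : Set} → (A → Bool) → List A → Bool
allB P = foldr (λ a b → P a ∧ b) true

anyB : {A : Set} → (A → Bool) → List A → Bool
anyB P = foldr (λ a b → P a ∨ b) false

countB : {A : Set} → (A → Bool) → List A → ℕ
countB P []       = zero
countB P (a ∷ as) = if P a then suc (countB P as) else countB P as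

filterB : {A : Set} → (A → Bool) → List A → List A
filterB P []       = []
filterB P (a ∷ as) = if P a then a ∷ filterB P as else filterB P as

_=F_ : {n : ℕ} → Fin n → Fin n → Bool
i =F j = toℕ i ≡ᵇ toℕ j

isPerm : {n : ℕ} → (Fin n → Fin n) → Bool
isPerm {n} σ = allB (λ i → allB (λ j → not (σ i =F σ j) ∨ (i =F j)) (allFin n)) (allFin n)

Perms : (n : ℕ) → List (Fin n → Fin n)
Perms n = filterB isPerm (allFuns n n)

iter : {n : ℕ} → (Fin n → Fin n) → ℕ → Fin n → Fin n
iter σ zero    i = i
iter σ (suc j) i = σ (iter σ j i)

exc : {n : ℕ} → (Fin n → Fin n) → ℕ
exc {n} σ = countB (λ i → toℕ i <ᵇ toℕ (σ i)) (allFin n)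

fix : {n : ℕ} → (Fin n → Fin n) → ℕ
fix {n} σ = countB (λ i → σ i =F i) (allFin n)

-- number of cycles = number of elements that are the least element of
-- their cycle (the orbit of i is {σ^j i : j < n})
cyc : {n : ℕ} → (Fin n → Fin n) → ℕ
cyc {n} σ = countB (λ i → allB (λ j → toℕ i ≤ᵇ toℕ (iter σ j i)) (upTo n)) (allFin n)

lastF : (n : ℕ) → Fin (suc n)
lastF n = fromℕ n

fcyc : {n : ℕ} → (Fin (suc n) → Fin (suc n)) → ℕ
fcyc {n} σ = countB (λ i → anyB (λ j → iter σ j (lastF n) =F i) (upTo (suc n))) (allFin (suc n))

-- membership in Q̂_{n+1}: the cycle (c₁,…,c_k,m) of m, with σ(m)=c₁,
-- σ(cᵢ)=cᵢ₊₁, σ(c_k)=m, has c₁<⋯<c_k. I.e. for every t ≥ 1 with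
-- σ^t(m) ≠ m and σ^{t+1}(m) ≠ m we have σ^t(m) < σ^{t+1}(m);
-- since the cycle has length ≤ n+1, t ∈ {1,…,n} suffices.
inQhat : {n : ℕ} → (Fin (suc n) → Fin (suc n)) → Bool
inQhat {n} σ = allB ok (upTo n)
  where
    ok : ℕ → Bool
    ok j = let a = iter σ (suc j) (lastF n)
               b = iter σ (suc (suc j)) (lastF n)
           in (a =F lastF n) ∨ (b =F lastF n) ∨ (toℕ a <ᵇ toℕ b)

Qhat : (n : ℕ) → List (Fin (suc n) → Fin (suc n))
Qhat n = filterB inQhat (Perms (suc n))

module _ {c ℓ : Level} (R : CommutativeRing c ℓ) where
  open CommutativeRing R using (Carrier; _+_; _*_; _-_; 0#; 1#)

  powR : Carrier → ℕ → Carrier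
  powR a zero    = 1#
  powR a (suc k) = a * powR a k

  natMul : ℕ → Carrier → Carrier
  natMul zero    a = 0#
  natMul (suc k) a = a + natMul k a

  sumR : List Carrier → Carrier
  sumR = foldr _+_ 0#

  -- A_n(x,y,q) for n ≥ 1, and coefficient 1 of z^0 in A(x,y,q;z)
  Acoef : Carrier → Carrier → Carrier → ℕ → Carrier
  Acoef x y q zero    = 1#
  Acoef x y q (suc n) =
    sumR (map (λ π → powR x (exc π) * powR y (fix π) * powR q (cyc π)) (Perms (suc n)))

  Atil : Carrier → Carrier → Carrier → Carrier → ℕ → Carrier
  Atil x y q p n =
    sumR (map (λ σ → powR x (exc σ) * powR y (fix σ) * powR q (cyc σ) * powR p (fcyc σ)) (Qhat n))

  -- n!·[z^k] of e^{xpz} + y - 1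
  expCoef : Carrier → Carrier → Carrier → ℕ → Carrier
  expCoef x y p zero    = powR (x * p) zero + (y - 1#)
  expCoef x y p (suc k) = powR (x * p) (suc k)

  -- n!·[z^n] of (e^{xpz}+y-1)·p·q·A(x,y,q;z)  (EGF product = binomial convolution)
  rhsCoef : Carrier → Carrier → Carrier → Carrier → ℕ → Carrier
  rhsCoef x y q p n =
    p * q * sumR (map (λ k → natMul (n C k) (expCoef x y p k * Acoef x y q (n ∸ k))) (upTo (suc n)))

-- Sort the σ ∈ Q̂_{n+1} by fcyc σ = k + 1. Such a σ is the same thing as a
-- shuffle θ recording which of the points 1,…,n lie on the cycle of m
-- (they are c₁ < ⋯ < c_k, so that cycle is forced) together with the
-- permutation τ that σ induces on the other n − k points. Under this
-- bijection exc σ = exc τ + k, fix σ = fix τ + [k = 0], cyc σ = cyc τ + 1,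
-- so the summand of σ is pq ((xp)^k + [k = 0](y − 1)) x^exc τ y^fix τ q^cyc τ.
-- Summing over the C(n,k) shuffles and all τ gives the k-th term of the
-- binomial convolution that is the coefficient of z^n/n! on the right.

module Submission where

open import Defs
open import Level using (Level)
open import Data.Nat using (ℕ; zero; suc; _≡ᵇ_; _<ᵇ_; _≤ᵇ_; _∸_; _+_; _≤_; _<_; z≤n; s≤s; z<s; s<s; s≤s⁻¹; pred; >-nonZero)
open import Data.Nat.Properties
open import Data.Nat.Combinatorics using (_C_; nCn≡1; nCk+nC[k+1]≡[n+1]C[k+1])
open import Data.Bool using (Bool; true; false; _∧_; _∨_; not; if_then_else_)
open import Data.Bool.Properties using (T-≡; ∧-identityʳ; ∧-zeroʳ; not-involutive)
open import Data.Fin using (Fin; toℕ; fromℕ; fromℕ<; inject₁) renaming (zero to fzero; suc to fsuc)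
open import Data.Fin.Properties using (toℕ-injective; toℕ<n; toℕ-fromℕ; toℕ-fromℕ<; pigeonhole)
open import Data.List using (List; []; _∷_; [_]; map; concatMap; allFin; upTo; tabulate; applyUpTo; _++_; length)
open import Data.List.Properties using (length-map; length-++; length-tabulate; map-applyUpTo; map-tabulate)
import Data.Vec.Functional as VF
open import Data.Product using (Σ; ∃; _×_; _,_; proj₁; proj₂; uncurry)
open import Data.Sum using (_⊎_; inj₁; inj₂) renaming (map to map⊎; [_,_] to case⊎)
open import Data.Sum.Properties using (inj₁-injective; inj₂-injective)
open import Data.Empty using (⊥-elim)
open import Function using (_∘_; id; case_of_; Equivalence)
open import Function.Definitions using (Injective)
open import Relation.Nullary using (¬_; yes; no)
open import Relation.Binary.PropositionalEquality using (_≡_; refl; sym; trans; cong; cong₂; subst; _≢_; module ≡-Reasoning)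
open import Induction.WellFounded using (Acc; acc)
open import Data.Nat.Induction using (<-wellFounded)
open import Algebra.Bundles using (CommutativeRing)

true≢false : true ≢ false
true≢false ()

≢true⇒≡false : ∀ {b} → b ≢ true → b ≡ false
≢true⇒≡false {true}  h = ⊥-elim (h refl)
≢true⇒≡false {false} _ = refl

not≡true⇒≡false : ∀ {b} → not b ≡ true → b ≡ false
not≡true⇒≡false {false} _ = refl

not≡false⇒≡true : ∀ {b} → not b ≡ false → b ≡ true
not≡false⇒≡true {true} _ = refl

∧-intro : ∀ {a b} → a ≡ true → b ≡ true → (a ∧ b) ≡ true
∧-intro refl refl = refl

∧-elimˡ : ∀ {a b} → (a ∧ b) ≡ true → a ≡ true
∧-elimˡ {true} _ = refl

∧-elimʳ : ∀ {a b} → (a ∧ b) ≡ true → b ≡ true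
∧-elimʳ {true} h = h

∨-elim : ∀ {a b} → (a ∨ b) ≡ true → a ≡ true ⊎ b ≡ true
∨-elim {true}  _ = inj₁ refl
∨-elim {false} h = inj₂ h

∨-introˡ : ∀ {a b} → a ≡ true → (a ∨ b) ≡ true
∨-introˡ refl = refl

∨-introʳ : ∀ a {b} → b ≡ true → (a ∨ b) ≡ true
∨-introʳ true  _ = refl
∨-introʳ false h = h

≡ᵇ-sound : ∀ {m n} → (m ≡ᵇ n) ≡ true → m ≡ n
≡ᵇ-sound {m} {n} h = ≡ᵇ⇒≡ m n (Equivalence.from T-≡ h)

≡ᵇ-complete : ∀ {m n} → m ≡ n → (m ≡ᵇ n) ≡ true
≡ᵇ-complete {m} {n} e = Equivalence.to T-≡ (≡⇒≡ᵇ m n e)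

≡ᵇ-false : ∀ {m n} → m ≢ n → (m ≡ᵇ n) ≡ false
≡ᵇ-false ne = ≢true⇒≡false (ne ∘ ≡ᵇ-sound)

<ᵇ-sound : ∀ {m n} → (m <ᵇ n) ≡ true → m < n
<ᵇ-sound {m} {n} h = <ᵇ⇒< m n (Equivalence.from T-≡ h)

<ᵇ-complete : ∀ {m n} → m < n → (m <ᵇ n) ≡ true
<ᵇ-complete h = Equivalence.to T-≡ (<⇒<ᵇ h)

<ᵇ-false : ∀ {m n} → ¬ (m < n) → (m <ᵇ n) ≡ false
<ᵇ-false ne = ≢true⇒≡false (ne ∘ <ᵇ-sound)

=F-sound : ∀ {n} {i j : Fin n} → (i =F j) ≡ true → i ≡ j
=F-sound h = toℕ-injective (≡ᵇ-sound h)

=F-complete : ∀ {n} {i j : Fin n} → i ≡ j → (i =F j) ≡ true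
=F-complete {i = i} refl = ≡ᵇ-complete {toℕ i} refl

=F-false : ∀ {n} {i j : Fin n} → i ≢ j → (i =F j) ≡ false
=F-false ne = ≢true⇒≡false (ne ∘ =F-sound)

=F-refl : ∀ {n} (i : Fin n) → (i =F i) ≡ true
=F-refl i = =F-complete {i = i} refl

countB-cong : ∀ {A : Set} {P Q : A → Bool} (L : List A) → (∀ a → P a ≡ Q a) → countB P L ≡ countB Q L
countB-cong []      h = refl
countB-cong {P = P} {Q} (a ∷ L) h rewrite h a with Q a
... | true  = cong suc (countB-cong L h)
... | false = countB-cong L h

allB-cong : ∀ {A : Set} {P Q : A → Bool} (L : List A) → (∀ a → P a ≡ Q a) → allB P L ≡ allB Q L
allB-cong []      h = refl
allB-cong (a ∷ L) h = cong₂ _∧_ (h a) (allB-cong L h)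

anyB-cong : ∀ {A : Set} {P Q : A → Bool} (L : List A) → (∀ a → P a ≡ Q a) → anyB P L ≡ anyB Q L
anyB-cong []      h = refl
anyB-cong (a ∷ L) h = cong₂ _∨_ (h a) (anyB-cong L h)

countB-map : ∀ {A B : Set} (P : B → Bool) (f : A → B) (L : List A) → countB P (map f L) ≡ countB (P ∘ f) L
countB-map P f [] = refl
countB-map P f (a ∷ L) with P (f a)
... | true  = cong suc (countB-map P f L)
... | false = countB-map P f L

allB-map : ∀ {A B : Set} (P : B → Bool) (f : A → B) (L : List A) → allB P (map f L) ≡ allB (P ∘ f) L
allB-map P f []      = refl
allB-map P f (a ∷ L) = cong (P (f a) ∧_) (allB-map P f L)

countB-++ : ∀ {A : Set} (P : A → Bool) (L M : List A) → countB P (L ++ M) ≡ countB P L + countB P M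
countB-++ P [] M = refl
countB-++ P (a ∷ L) M with P a
... | true  = cong suc (countB-++ P L M)
... | false = countB-++ P L M

countB-concatMap : ∀ {A B : Set} (P : B → Bool) (Q : A → Bool) (h : A → List B) (L : List A) →
                   (∀ a → countB P (h a) ≡ (if Q a then 1 else 0)) → countB P (concatMap h L) ≡ countB Q L
countB-concatMap P Q h [] e = refl
countB-concatMap P Q h (a ∷ L) e with Q a in q
... | true  = trans (countB-++ P (h a) (concatMap h L)) (cong₂ _+_ (trans (e a) (cong (λ b → if b then 1 else 0) q)) (countB-concatMap P Q h L e))
... | false = trans (countB-++ P (h a) (concatMap h L)) (cong₂ _+_ (trans (e a) (cong (λ b → if b then 1 else 0) q)) (countB-concatMap P Q h L e))

countB-none : ∀ {A : Set} (P : A → Bool) (L : List A) → (∀ a → P a ≡ false) → countB P L ≡ 0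
countB-none P []      h = refl
countB-none P (a ∷ L) h rewrite h a = countB-none P L h

countB-all : ∀ {A : Set} (P : A → Bool) (L : List A) → (∀ a → P a ≡ true) → countB P L ≡ length L
countB-all P []      h = refl
countB-all P (a ∷ L) h rewrite h a = cong suc (countB-all P L h)

countB-head : ∀ {A : Set} (P : A → Bool) (L : List A) {a} → P a ≡ true → countB P (a ∷ L) ≡ suc (countB P L)
countB-head P L e rewrite e = refl

countB-≤ : ∀ {A : Set} (P : A → Bool) (L : List A) → countB P L ≤ length L
countB-≤ P [] = z≤n
countB-≤ P (a ∷ L) with P a
... | true  = s≤s (countB-≤ P L)
... | false = m≤n⇒m≤1+n (countB-≤ P L)

countB-not : ∀ {A : Set} (P : A → Bool) (L : List A) → countB (not ∘ P) L + countB P L ≡ length L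
countB-not P [] = refl
countB-not P (a ∷ L) with P a
... | true  = trans (+-suc _ _) (cong suc (countB-not P L))
... | false = cong suc (countB-not P L)

allB-tabulate⁻ : ∀ {A : Set} {n} (P : A → Bool) (f : Fin n → A) → allB P (tabulate f) ≡ true → ∀ i → P (f i) ≡ true
allB-tabulate⁻ P f h fzero    = ∧-elimˡ h
allB-tabulate⁻ P f h (fsuc i) = allB-tabulate⁻ P (f ∘ fsuc) (∧-elimʳ {P (f fzero)} h) i

allB-tabulate⁺ : ∀ {A : Set} {n} (P : A → Bool) (f : Fin n → A) → (∀ i → P (f i) ≡ true) → allB P (tabulate f) ≡ true
allB-tabulate⁺ {n = zero}  P f h = refl
allB-tabulate⁺ {n = suc n} P f h = ∧-intro (h fzero) (allB-tabulate⁺ P (f ∘ fsuc) (h ∘ fsuc))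

allB-applyUpTo⁻ : ∀ {A : Set} (P : A → Bool) (f : ℕ → A) n → allB P (applyUpTo f n) ≡ true → ∀ j → j < n → P (f j) ≡ true
allB-applyUpTo⁻ P f (suc n) h zero    _         = ∧-elimˡ h
allB-applyUpTo⁻ P f (suc n) h (suc j) (s<s j<n) = allB-applyUpTo⁻ P (f ∘ suc) n (∧-elimʳ {P (f 0)} h) j j<n

allB-applyUpTo⁺ : ∀ {A : Set} (P : A → Bool) (f : ℕ → A) n → (∀ j → j < n → P (f j) ≡ true) → allB P (applyUpTo f n) ≡ true
allB-applyUpTo⁺ P f zero    h = refl
allB-applyUpTo⁺ P f (suc n) h = ∧-intro (h 0 z<s) (allB-applyUpTo⁺ P (f ∘ suc) n (λ j j<n → h (suc j) (s<s j<n)))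

anyB-applyUpTo⁻ : ∀ {A : Set} (P : A → Bool) (f : ℕ → A) n → anyB P (applyUpTo f n) ≡ true → ∃ λ j → j < n × P (f j) ≡ true
anyB-applyUpTo⁻ P f (suc n) h with ∨-elim {P (f 0)} h
... | inj₁ e = 0 , z<s , e
... | inj₂ e with anyB-applyUpTo⁻ P (f ∘ suc) n e
... | j , j<n , e' = suc j , s<s j<n , e'

anyB-applyUpTo⁺ : ∀ {A : Set} (P : A → Bool) (f : ℕ → A) n j → j < n → P (f j) ≡ true → anyB P (applyUpTo f n) ≡ true
anyB-applyUpTo⁺ P f (suc n) zero    _         h = ∨-introˡ h
anyB-applyUpTo⁺ P f (suc n) (suc j) (s<s j<n) h = ∨-introʳ (P (f 0)) (anyB-applyUpTo⁺ P (f ∘ suc) n j j<n h)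

tabulate≡map-allFin : ∀ {A : Set} {n} (f : Fin n → A) → tabulate f ≡ map f (allFin n)
tabulate≡map-allFin f = sym (map-tabulate id f)

countB-tabulate : ∀ {A : Set} {n} (P : A → Bool) (f : Fin n → A) → countB P (tabulate f) ≡ countB (P ∘ f) (allFin n)
countB-tabulate {n = n} P f = trans (cong (countB P) (tabulate≡map-allFin f)) (countB-map P f (allFin n))

allB-tabulate : ∀ {A : Set} {n} (P : A → Bool) (f : Fin n → A) → allB P (tabulate f) ≡ allB (P ∘ f) (allFin n)
allB-tabulate {n = n} P f = trans (cong (allB P) (tabulate≡map-allFin f)) (allB-map P f (allFin n))

countB-allFin-≤ : ∀ {n} (P : Fin n → Bool) → countB P (allFin n) ≤ n
countB-allFin-≤ {n} P = ≤-trans (countB-≤ P (allFin n)) (≤-reflexive (length-tabulate id))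

countB-allFin-=F : ∀ {n} (j : Fin n) → countB (j =F_) (allFin n) ≡ 1
countB-allFin-=F {suc n} fzero    = cong suc (trans (countB-tabulate {n = n} (fzero =F_) fsuc) (countB-none _ (allFin n) (λ i → refl)))
countB-allFin-=F {suc n} (fsuc j) = trans (countB-tabulate {n = n} (fsuc j =F_) fsuc) (countB-allFin-=F j)

countB-allFin-last : ∀ {n} (P : Fin (suc n) → Bool) → countB P (allFin (suc n)) ≡ countB (P ∘ inject₁) (allFin n) + (if P (fromℕ n) then 1 else 0)
countB-allFin-last {zero} P with P fzero
... | true  = refl
... | false = refl
countB-allFin-last {suc n} P with P fzero | shifted
  where
  shifted : countB P (tabulate fsuc) ≡ countB (P ∘ inject₁) (tabulate fsuc) + (if P (fromℕ (suc n)) then 1 else 0)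
  shifted = trans (countB-tabulate P fsuc)
                  (trans (countB-allFin-last (P ∘ fsuc)) (cong (_+ (if P (fromℕ (suc n)) then 1 else 0)) (sym (countB-tabulate (P ∘ inject₁) fsuc))))
... | true  | e = cong suc e
... | false | e = e

anyB-applyUpTo-false⁻ : ∀ {A : Set} (P : A → Bool) (f : ℕ → A) n → anyB P (applyUpTo f n) ≡ false → ∀ j → j < n → P (f j) ≡ false
anyB-applyUpTo-false⁻ P f n h j lt = ≢true⇒≡false (λ e → true≢false (trans (sym (anyB-applyUpTo⁺ P f n j lt e)) h))

countB-upTo-≡ᵇ : ∀ N k₀ → k₀ < N → countB (k₀ ≡ᵇ_) (upTo N) ≡ 1
countB-upTo-≡ᵇ (suc N) k₀ k₀<N = trans (cong (countB (k₀ ≡ᵇ_) ∘ (0 ∷_)) (sym (map-applyUpTo id suc N))) (shifted k₀ k₀<N)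
  where
  shifted : ∀ k₀ → k₀ < suc N → countB (k₀ ≡ᵇ_) (0 ∷ map suc (upTo N)) ≡ 1
  shifted zero     _             = cong suc (trans (countB-map _ suc (upTo N)) (countB-none _ (upTo N) (λ _ → refl)))
  shifted (suc k₀) (s<s k₀<N)    = trans (countB-map _ suc (upTo N)) (countB-upTo-≡ᵇ N k₀ k₀<N)

-- Functions Fin m → Fin n are enumerated only up to pointwise equality.
record Enumeration (A : Set) : Set where
  field
    _≈ᵇ_     : A → A → Bool
    ≈ᵇ-refl  : ∀ a → (a ≈ᵇ a) ≡ true
    ≈ᵇ-sym   : ∀ {a b} → (a ≈ᵇ b) ≡ true → (b ≈ᵇ a) ≡ true
    ≈ᵇ-trans : ∀ {a b d} → (a ≈ᵇ b) ≡ true → (b ≈ᵇ d) ≡ true → (a ≈ᵇ d) ≡ true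
    elements : List A
    unique   : ∀ a → countB (a ≈ᵇ_) elements ≡ 1

_≈[_]_ : ∀ {A : Set} → A → Enumeration A → A → Bool
a ≈[ X ] b = Enumeration._≈ᵇ_ X a b

_≗ᵇ_ : ∀ {m n} → (Fin m → Fin n) → (Fin m → Fin n) → Bool
_≗ᵇ_ {m} f g = allB (λ i → f i =F g i) (allFin m)

≗ᵇ-sound : ∀ {m n} {f g : Fin m → Fin n} → (f ≗ᵇ g) ≡ true → ∀ i → f i ≡ g i
≗ᵇ-sound {f = f} {g} h i = =F-sound (allB-tabulate⁻ (λ i → f i =F g i) id h i)

≗ᵇ-complete : ∀ {m n} {f g : Fin m → Fin n} → (∀ i → f i ≡ g i) → (f ≗ᵇ g) ≡ true
≗ᵇ-complete {f = f} {g} h = allB-tabulate⁺ (λ i → f i =F g i) id (λ i → =F-complete (h i))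

allFuns-unique : ∀ m n (h : Fin m → Fin n) → countB (h ≗ᵇ_) (allFuns m n) ≡ 1
allFuns-unique zero    n h = refl
allFuns-unique (suc m) n h =
  trans (countB-concatMap (h ≗ᵇ_) ((h ∘ fsuc) ≗ᵇ_) _ (allFuns m n) extensions) (allFuns-unique m n (h ∘ fsuc))
  where
  head-and-tail : ∀ f a → (h ≗ᵇ (a VF.∷ f)) ≡ ((h fzero =F a) ∧ ((h ∘ fsuc) ≗ᵇ f))
  head-and-tail f a = cong ((h fzero =F a) ∧_) (allB-tabulate (λ i → h i =F (a VF.∷ f) i) fsuc)

  count-heads : ∀ b → countB (λ a → (h fzero =F a) ∧ b) (allFin n) ≡ (if b then 1 else 0)
  count-heads true  = trans (countB-cong (allFin n) (λ a → ∧-identityʳ (h fzero =F a))) (countB-allFin-=F (h fzero))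
  count-heads false = countB-none _ (allFin n) (λ a → ∧-zeroʳ (h fzero =F a))

  extensions : ∀ f → countB (h ≗ᵇ_) (map (VF._∷ f) (allFin n)) ≡ (if (h ∘ fsuc) ≗ᵇ f then 1 else 0)
  extensions f = trans (countB-map (h ≗ᵇ_) (VF._∷ f) (allFin n))
                       (trans (countB-cong (allFin n) (head-and-tail f)) (count-heads ((h ∘ fsuc) ≗ᵇ f)))

functions : ∀ m n → Enumeration (Fin m → Fin n)
functions m n = record
  { _≈ᵇ_     = _≗ᵇ_
  ; ≈ᵇ-refl  = λ f → ≗ᵇ-complete {f = f} (λ _ → refl)
  ; ≈ᵇ-sym   = λ {f} {g} h → ≗ᵇ-complete (λ i → sym (≗ᵇ-sound {f = f} {g} h i))
  ; ≈ᵇ-trans = λ {f} {g} {k} h h' → ≗ᵇ-complete (λ i → trans (≗ᵇ-sound {f = f} {g} h i) (≗ᵇ-sound {f = g} {k} h' i))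
  ; elements = allFuns m n
  ; unique   = allFuns-unique m n
  }

_×ᴱ_ : ∀ {A B : Set} → Enumeration A → Enumeration B → Enumeration (A × B)
_×ᴱ_ {A} {B} X Y = record
  { _≈ᵇ_     = _≈ᵇ×_
  ; ≈ᵇ-refl  = λ (a , b) → ∧-intro (X.≈ᵇ-refl a) (Y.≈ᵇ-refl b)
  ; ≈ᵇ-sym   = λ {(a , _)} {(a' , _)} h → ∧-intro (X.≈ᵇ-sym (∧-elimˡ h)) (Y.≈ᵇ-sym (∧-elimʳ {a X.≈ᵇ a'} h))
  ; ≈ᵇ-trans = λ {(a , _)} {(a' , _)} {_} h h' →
                 ∧-intro (X.≈ᵇ-trans (∧-elimˡ h) (∧-elimˡ h')) (Y.≈ᵇ-trans (∧-elimʳ {a X.≈ᵇ a'} h) (∧-elimʳ h'))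
  ; elements = concatMap (λ a → map (a ,_) Y.elements) X.elements
  ; unique   = unique
  }
  where
  module X = Enumeration X
  module Y = Enumeration Y

  _≈ᵇ×_ : A × B → A × B → Bool
  (a , b) ≈ᵇ× (a' , b') = (a X.≈ᵇ a') ∧ (b Y.≈ᵇ b')

  unique : ∀ p → countB (p ≈ᵇ×_) (concatMap (λ a → map (a ,_) Y.elements) X.elements) ≡ 1
  unique (a , b) = trans (countB-concatMap _ (a X.≈ᵇ_) _ X.elements fibre) (X.unique a)
    where
    fibre : ∀ a' → countB ((a , b) ≈ᵇ×_) (map (a' ,_) Y.elements) ≡ (if a X.≈ᵇ a' then 1 else 0)
    fibre a' with a X.≈ᵇ a' in e
    ... | true  = trans (countB-map _ (a' ,_) Y.elements) (trans (countB-cong Y.elements (λ x → cong (_∧ (b Y.≈ᵇ x)) e)) (Y.unique b))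
    ... | false = trans (countB-map _ (a' ,_) Y.elements) (countB-none _ Y.elements (λ x → cong (_∧ (b Y.≈ᵇ x)) e))

module Sums {c ℓ : Level} (R : CommutativeRing c ℓ) where
  private module R = CommutativeRing R
  open R hiding (_+_; refl; sym; trans; +-assoc; +-comm; +-identityˡ; +-identityʳ; *-identityˡ; *-identityʳ; *-assoc; *-comm)
  open R using () renaming (_+_ to _+ᴿ_; refl to ≈-refl; sym to ≈-sym; trans to ≈-trans)
  open import Algebra.Properties.CommutativeSemigroup R.+-commutativeSemigroup using (interchange)
  open import Relation.Binary.Reasoning.Setoid setoid

  sumMap : ∀ {A : Set} → (A → Carrier) → List A → Carrier
  sumMap g L = sumR R (map g L)

  sumMapIf : ∀ {A : Set} → (A → Bool) → (A → Carrier) → List A → Carrier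
  sumMapIf P g L = sumMap (λ a → if P a then g a else 0#) L

  sumMap-cong : ∀ {A : Set} {g h : A → Carrier} (L : List A) → (∀ a → g a ≈ h a) → sumMap g L ≈ sumMap h L
  sumMap-cong []      e = ≈-refl
  sumMap-cong (a ∷ L) e = +-cong (e a) (sumMap-cong L e)

  sumMap-cong-upTo : ∀ {g h : ℕ → Carrier} n → (∀ j → j < n → g j ≈ h j) → sumMap g (upTo n) ≈ sumMap h (upTo n)
  sumMap-cong-upTo {g} {h} n e = go n id e
    where
    go : ∀ m (f : ℕ → ℕ) → (∀ j → j < m → g (f j) ≈ h (f j)) → sumMap g (applyUpTo f m) ≈ sumMap h (applyUpTo f m)
    go zero    f e' = ≈-refl
    go (suc m) f e' = +-cong (e' 0 z<s) (go m (f ∘ suc) (λ j lt → e' (suc j) (s<s lt)))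

  sumMapIf-cong : ∀ {A : Set} (P : A → Bool) {g h : A → Carrier} (L : List A) →
                  (∀ a → P a ≡ true → g a ≈ h a) → sumMapIf P g L ≈ sumMapIf P h L
  sumMapIf-cong P L e = sumMap-cong L pointwise
    where
    pointwise : ∀ a → (if P a then _ else 0#) ≈ (if P a then _ else 0#)
    pointwise a with P a in eq
    ... | true  = e a eq
    ... | false = ≈-refl

  sumMap-map : ∀ {A B : Set} (g : B → Carrier) (f : A → B) (L : List A) → sumMap g (map f L) ≡ sumMap (g ∘ f) L
  sumMap-map g f []      = refl
  sumMap-map g f (a ∷ L) = cong (g (f a) +ᴿ_) (sumMap-map g f L)

  sumMap-++ : ∀ {A : Set} (g : A → Carrier) (L M : List A) → sumMap g (L ++ M) ≈ sumMap g L +ᴿ sumMap g M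
  sumMap-++ g []      M = ≈-sym (R.+-identityˡ _)
  sumMap-++ g (a ∷ L) M = ≈-trans (+-cong ≈-refl (sumMap-++ g L M)) (≈-sym (R.+-assoc _ _ _))

  sumMap-concatMap : ∀ {A B : Set} (g : B → Carrier) (h : A → List B) (L : List A) →
                     sumMap g (concatMap h L) ≈ sumMap (λ a → sumMap g (h a)) L
  sumMap-concatMap g h []      = ≈-refl
  sumMap-concatMap g h (a ∷ L) = ≈-trans (sumMap-++ g (h a) (concatMap h L)) (+-cong ≈-refl (sumMap-concatMap g h L))

  sumMap-+ : ∀ {A : Set} (g h : A → Carrier) (L : List A) → sumMap (λ a → g a +ᴿ h a) L ≈ sumMap g L +ᴿ sumMap h L
  sumMap-+ g h []      = ≈-sym (R.+-identityˡ _)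
  sumMap-+ g h (a ∷ L) = ≈-trans (+-cong ≈-refl (sumMap-+ g h L)) (interchange _ _ _ _)

  sumMap-zero : ∀ {A : Set} (g : A → Carrier) (L : List A) → (∀ a → g a ≈ 0#) → sumMap g L ≈ 0#
  sumMap-zero g []      e = ≈-refl
  sumMap-zero g (a ∷ L) e = ≈-trans (+-cong (e a) (sumMap-zero g L e)) (R.+-identityˡ _)

  sumMap-swap : ∀ {A B : Set} (F : A → B → Carrier) (L : List A) (M : List B) →
                sumMap (λ a → sumMap (F a) M) L ≈ sumMap (λ b → sumMap (λ a → F a b) L) M
  sumMap-swap F []      M = ≈-sym (sumMap-zero _ M (λ b → ≈-refl))
  sumMap-swap F (a ∷ L) M = ≈-trans (+-cong ≈-refl (sumMap-swap F L M)) (≈-sym (sumMap-+ _ _ M))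

  sumMap-*ˡ : ∀ {A : Set} (k : Carrier) (g : A → Carrier) (L : List A) → sumMap (λ a → k * g a) L ≈ k * sumMap g L
  sumMap-*ˡ k g []      = ≈-sym (zeroʳ k)
  sumMap-*ˡ k g (a ∷ L) = ≈-trans (+-cong ≈-refl (sumMap-*ˡ k g L)) (≈-sym (distribˡ _ _ _))

  sumMapIf-*ˡ : ∀ {A : Set} (P : A → Bool) (k : Carrier) (g : A → Carrier) (L : List A) →
                sumMapIf P (λ a → k * g a) L ≈ k * sumMapIf P g L
  sumMapIf-*ˡ P k g L = ≈-trans (sumMap-cong L pointwise) (sumMap-*ˡ k _ L)
    where
    pointwise : ∀ a → (if P a then k * g a else 0#) ≈ k * (if P a then g a else 0#)
    pointwise a with P a
    ... | true  = ≈-refl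
    ... | false = ≈-sym (zeroʳ k)

  sumMap-filterB : ∀ {A : Set} (P : A → Bool) (g : A → Carrier) (L : List A) → sumMap g (filterB P L) ≈ sumMapIf P g L
  sumMap-filterB P g [] = ≈-refl
  sumMap-filterB P g (a ∷ L) with P a
  ... | true  = +-cong ≈-refl (sumMap-filterB P g L)
  ... | false = ≈-trans (sumMap-filterB P g L) (≈-sym (R.+-identityˡ _))

  sumMapIf-filterB : ∀ {A : Set} (P Q : A → Bool) (g : A → Carrier) (L : List A) →
                     sumMapIf Q g (filterB P L) ≈ sumMapIf (λ a → P a ∧ Q a) g L
  sumMapIf-filterB P Q g [] = ≈-refl
  sumMapIf-filterB P Q g (a ∷ L) with P a
  ... | true  = +-cong ≈-refl (sumMapIf-filterB P Q g L)
  ... | false = ≈-trans (sumMapIf-filterB P Q g L) (≈-sym (R.+-identityˡ _))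

  natMul-*ˡ : ∀ k a b → natMul R k (a * b) ≈ a * natMul R k b
  natMul-*ˡ zero    a b = ≈-sym (zeroʳ a)
  natMul-*ˡ (suc k) a b = ≈-trans (+-cong ≈-refl (natMul-*ˡ k a b)) (≈-sym (distribˡ _ _ _))

  natMul-indicator : ∀ b a → natMul R (if b then 1 else 0) a ≈ (if b then a else 0#)
  natMul-indicator true  a = R.+-identityʳ a
  natMul-indicator false a = ≈-refl

  sumMap-const : ∀ {A : Set} (k : Carrier) (L : List A) → sumMap (λ _ → k) L ≈ natMul R (length L) k
  sumMap-const k []      = ≈-refl
  sumMap-const k (a ∷ L) = +-cong ≈-refl (sumMap-const k L)

  sumMapIf-const : ∀ {A : Set} (P : A → Bool) (k : Carrier) (L : List A) →
                   sumMapIf P (λ _ → k) L ≈ natMul R (countB P L) k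
  sumMapIf-const P k [] = ≈-refl
  sumMapIf-const P k (a ∷ L) with P a
  ... | true  = +-cong ≈-refl (sumMapIf-const P k L)
  ... | false = ≈-trans (R.+-identityˡ _) (sumMapIf-const P k L)

  sumMapIf-fibres : ∀ {A B : Set} (P : A → Bool) (Over : A → B → Bool) (g : A → Carrier) (L : List A) (M : List B) →
                    (∀ a → countB (Over a) M ≡ (if P a then 1 else 0)) →
                    sumMapIf P g L ≈ sumMap (λ b → sumMapIf (λ a → Over a b) g L) M
  sumMapIf-fibres P Over g L M fibre = begin
    sumMapIf P g L                                                     ≈⟨ sumMap-cong L spread ⟩
    sumMap (λ a → sumMap (λ b → if Over a b then g a else 0#) M) L     ≈⟨ sumMap-swap _ L M ⟩
    sumMap (λ b → sumMapIf (λ a → Over a b) g L) M                     ∎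
    where
    spread : ∀ a → (if P a then g a else 0#) ≈ sumMapIf (Over a) (λ _ → g a) M
    spread a = ≈-sym (begin
      sumMapIf (Over a) (λ _ → g a) M         ≈⟨ sumMapIf-const (Over a) (g a) M ⟩
      natMul R (countB (Over a) M) (g a)      ≡⟨ cong (λ j → natMul R j (g a)) (fibre a) ⟩
      natMul R (if P a then 1 else 0) (g a)   ≈⟨ natMul-indicator (P a) (g a) ⟩
      (if P a then g a else 0#)               ∎)

  sumMapIf-bijection :
    ∀ {A B : Set} (X : Enumeration A) (Y : Enumeration B) →
    (P : A → Bool) (Q : B → Bool) (g : A → Carrier) (φ : B → A) (ψ : A → B) →
    (∀ {a a'} → (a ≈[ X ] a') ≡ true → g a ≈ g a') →
    (∀ {a a'} → (a ≈[ X ] a') ≡ true → P a ≡ P a') →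
    (∀ {b b'} → (b ≈[ Y ] b') ≡ true → Q b ≡ Q b') →
    (∀ {b b'} → (b ≈[ Y ] b') ≡ true → (φ b ≈[ X ] φ b') ≡ true) →
    (∀ {a a'} → (a ≈[ X ] a') ≡ true → (ψ a ≈[ Y ] ψ a') ≡ true) →
    (∀ a → P a ≡ true → Q (ψ a) ≡ true) →
    (∀ a → P a ≡ true → (φ (ψ a) ≈[ X ] a) ≡ true) →
    (∀ b → Q b ≡ true → (ψ (φ b) ≈[ Y ] b) ≡ true) →
    (∀ b → Q b ≡ true → P (φ b) ≡ true) →
    sumMapIf P g (Enumeration.elements X) ≈ sumMapIf Q (g ∘ φ) (Enumeration.elements Y)
  sumMapIf-bijection X Y P Q g φ ψ g-cong P-cong Q-cong φ-cong ψ-cong ψ-maps φ∘ψ ψ∘φ φ-maps = begin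
    sumMapIf P g X.elements                                      ≈⟨ sumMapIf-fibres P Over g X.elements Y.elements fibre ⟩
    sumMap (λ b → sumMapIf (λ a → Over a b) g X.elements) Y.elements ≈⟨ sumMap-cong Y.elements collapse ⟩
    sumMapIf Q (g ∘ φ) Y.elements                                ∎
    where
    module X = Enumeration X
    module Y = Enumeration Y

    Over : _ → _ → Bool
    Over a b = Q b ∧ (φ b X.≈ᵇ a)

    over-image : ∀ a → P a ≡ true → ∀ b → Over a b ≡ (ψ a Y.≈ᵇ b)
    over-image a pa b with ψ a Y.≈ᵇ b in e
    ... | true = ∧-intro (trans (sym (Q-cong e)) (ψ-maps a pa)) (X.≈ᵇ-trans (φ-cong (Y.≈ᵇ-sym e)) (φ∘ψ a pa))
    ... | false with Q b in qb
    ... | false = refl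
    ... | true with φ b X.≈ᵇ a in e′
    ... | false = refl
    ... | true = ⊥-elim (true≢false (trans (sym (Y.≈ᵇ-trans (Y.≈ᵇ-sym (ψ-cong e′)) (ψ∘φ b qb))) e))

    over-nothing : ∀ a → P a ≡ false → ∀ b → Over a b ≡ false
    over-nothing a pa b with Q b in qb
    ... | false = refl
    ... | true with φ b X.≈ᵇ a in e′
    ... | false = refl
    ... | true = ⊥-elim (true≢false (trans (sym (trans (sym (P-cong e′)) (φ-maps b qb))) pa))

    fibre : ∀ a → countB (Over a) Y.elements ≡ (if P a then 1 else 0)
    fibre a with P a in pa
    ... | true  = trans (countB-cong Y.elements (over-image a pa)) (Y.unique (ψ a))
    ... | false = trans (countB-cong Y.elements (over-nothing a pa)) (countB-none _ Y.elements (λ _ → refl))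

    collapse : ∀ b → sumMapIf (λ a → Over a b) g X.elements ≈ (if Q b then g (φ b) else 0#)
    collapse b with Q b
    ... | false = sumMap-zero _ X.elements (λ _ → ≈-refl)
    ... | true  = begin
      sumMapIf (φ b X.≈ᵇ_) g X.elements              ≈⟨ sumMapIf-cong (φ b X.≈ᵇ_) X.elements (λ a e → ≈-sym (g-cong e)) ⟩
      sumMapIf (φ b X.≈ᵇ_) (λ _ → g (φ b)) X.elements ≈⟨ sumMapIf-const _ _ X.elements ⟩
      natMul R (countB (φ b X.≈ᵇ_) X.elements) (g (φ b)) ≡⟨ cong (λ j → natMul R j (g (φ b))) (X.unique (φ b)) ⟩
      natMul R 1 (g (φ b))                           ≈⟨ R.+-identityʳ _ ⟩
      g (φ b)                                        ∎

isPerm-sound : ∀ {n} (σ : Fin n → Fin n) → isPerm σ ≡ true → Injective _≡_ _≡_ σ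
isPerm-sound {n} σ h {i} {j} e with allB-tabulate⁻ (λ j → not (σ i =F σ j) ∨ (i =F j)) id (allB-tabulate⁻ _ id h i) j
... | h' with ∨-elim {not (σ i =F σ j)} h'
... | inj₁ x = ⊥-elim (true≢false (trans (sym (=F-complete e)) (not≡true⇒≡false x)))
... | inj₂ x = =F-sound x

isPerm-complete : ∀ {n} (σ : Fin n → Fin n) → Injective _≡_ _≡_ σ → isPerm σ ≡ true
isPerm-complete {n} σ inj = allB-tabulate⁺ _ id (λ i → allB-tabulate⁺ _ id (pair i))
  where
  pair : ∀ i j → (not (σ i =F σ j) ∨ (i =F j)) ≡ true
  pair i j with σ i =F σ j in e
  ... | false = refl
  ... | true = =F-complete (inj (=F-sound e))

isPerm-cong : ∀ {n} {σ σ' : Fin n → Fin n} → (∀ i → σ i ≡ σ' i) → isPerm σ ≡ isPerm σ'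
isPerm-cong {n} {σ} {σ'} e = allB-cong (allFin n) (λ i → allB-cong (allFin n) (λ j → cong₂ (λ a b → not (a =F b) ∨ (i =F j)) (e i) (e j)))

iter-cong : ∀ {n} {σ σ' : Fin n → Fin n} → (∀ i → σ i ≡ σ' i) → ∀ j i → iter σ j i ≡ iter σ' j i
iter-cong e zero i = refl
iter-cong {σ = σ} {σ'} e (suc j) i = trans (cong σ (iter-cong e j i)) (e _)

iter-+ : ∀ {n} (σ : Fin n → Fin n) a d i → iter σ (a + d) i ≡ iter σ a (iter σ d i)
iter-+ σ zero d i = refl
iter-+ σ (suc a) d i = cong σ (iter-+ σ a d i)

iter-sucʳ : ∀ {n} (σ : Fin n → Fin n) j i → iter σ (suc j) i ≡ iter σ j (σ i)
iter-sucʳ σ j i = trans (cong (λ t → iter σ t i) (+-comm 1 j)) (iter-+ σ j 1 i)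

iter-inj : ∀ {n} (σ : Fin n → Fin n) → Injective _≡_ _≡_ σ → ∀ a {x y} → iter σ a x ≡ iter σ a y → x ≡ y
iter-inj σ inj zero e = e
iter-inj σ inj (suc a) e = iter-inj σ inj a (inj e)

iter-period : ∀ {n} (σ : Fin n → Fin n) → Injective _≡_ _≡_ σ → ∀ i → ∃ λ d → 0 < d × d ≤ n × iter σ d i ≡ i
iter-period {n} σ inj i with pigeonhole (n<1+n n) (λ (t : Fin (suc n)) → iter σ (toℕ t) i)
... | a , b , a<b , e = d , d>0 , d≤n , sym (iter-inj σ inj (toℕ a) e')
  where
  d : ℕ
  d = toℕ b ∸ toℕ a
  d>0 : 0 < d
  d>0 = m<n⇒0<n∸m a<b
  d≤n : d ≤ n
  d≤n = ≤-trans (m∸n≤m (toℕ b) (toℕ a)) (s≤s⁻¹ (toℕ<n b))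
  e' : iter σ (toℕ a) i ≡ iter σ (toℕ a) (iter σ d i)
  e' = trans e (trans (cong (λ t → iter σ t i) (sym (m+[n∸m]≡n (<⇒≤ a<b)))) (iter-+ σ (toℕ a) d i))

iter-reduce : ∀ {n} (σ : Fin n → Fin n) i d → 0 < d → iter σ d i ≡ i → ∀ t → ∃ λ t' → t' < d × iter σ t i ≡ iter σ t' i
iter-reduce σ i d d>0 e zero = 0 , d>0 , refl
iter-reduce σ i d d>0 e (suc t) with iter-reduce σ i d d>0 e t
... | t' , t'<d , e' with m≤n⇒m<n∨m≡n (t'<d)
... | inj₁ st'<d = suc t' , st'<d , cong σ e'
... | inj₂ st'≡d = 0 , d>0 , trans (cong σ e') (trans (cong (λ x → iter σ x i) st'≡d) e)

iter-reduce-below : ∀ {n} (σ : Fin n → Fin n) → Injective _≡_ _≡_ σ → ∀ i t → ∃ λ t' → t' < n × iter σ t i ≡ iter σ t' i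
iter-reduce-below {n} σ inj i t with iter-period σ inj i
... | d , d>0 , d≤n , e with iter-reduce σ i d d>0 e t
... | t' , t'<d , e' = t' , ≤-trans t'<d d≤n , e'

allB-iterates-upTo-≥ : ∀ {r} (τ : Fin r → Fin r) → Injective _≡_ _≡_ τ → (Q : Fin r → Bool) (j : Fin r) (N : ℕ) → r ≤ N →
            allB (λ t → Q (iter τ t j)) (upTo N) ≡ allB (λ t → Q (iter τ t j)) (upTo r)
allB-iterates-upTo-≥ {r} τ inj Q j N r≤N with allB (λ t → Q (iter τ t j)) (upTo r) in e
... | true = allB-applyUpTo⁺ _ id N (λ t _ → holds t)
  where
  holds : ∀ t → Q (iter τ t j) ≡ true
  holds t with iter-reduce-below τ inj j t
  ... | t' , t'<r , e' = trans (cong Q e') (allB-applyUpTo⁻ _ id r e t' t'<r)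
... | false with allB (λ t → Q (iter τ t j)) (upTo N) in e2
... | false = refl
... | true = ⊥-elim (true≢false (trans (sym (allB-applyUpTo⁺ _ id r (λ t t<r → allB-applyUpTo⁻ _ id N e2 t (≤-trans t<r r≤N)))) e))

iter-minimal-return : ∀ {n} (σ : Fin n → Fin n) → Injective _≡_ _≡_ σ → ∀ x →
  ∃ λ L → 0 < L × L ≤ n × iter σ L x ≡ x × (∀ t → 0 < t → t < L → iter σ t x ≢ x)
iter-minimal-return {n} σ inj x with iter-period σ inj x
... | d , d>0 , d≤n , returns with shorten d (<-wellFounded d) d>0 returns
  where
  shorten : ∀ d → Acc _<_ d → 0 < d → iter σ d x ≡ x →
            ∃ λ L → 0 < L × L ≤ d × iter σ L x ≡ x × (∀ t → 0 < t → t < L → iter σ t x ≢ x)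
  shorten d (acc smaller) d>0 returns with anyB (λ t → (0 <ᵇ t) ∧ (iter σ t x =F x)) (upTo d) in earlier
  ... | false = d , d>0 , ≤-refl , returns , λ t t>0 t<d back →
                  true≢false (trans (sym (∧-intro (<ᵇ-complete t>0) (=F-complete back))) (anyB-applyUpTo-false⁻ _ id d earlier t t<d))
  ... | true with anyB-applyUpTo⁻ _ id d earlier
  ... | t , t<d , h with shorten t (smaller t<d) (<ᵇ-sound (∧-elimˡ h)) (=F-sound (∧-elimʳ {0 <ᵇ t} h))
  ... | L , L>0 , L≤t , back , first = L , L>0 , ≤-trans L≤t (<⇒≤ t<d) , back , first
... | L , L>0 , L≤d , back , first = L , L>0 , ≤-trans L≤d d≤n , back , first

-- Shuffles of r left and k right positions into Fin n

data Shuffle : ℕ → ℕ → ℕ → Set where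
  done : Shuffle 0 0 0
  left : ∀ {n r k} → Shuffle n r k → Shuffle (suc n) (suc r) k
  right : ∀ {n r k} → Shuffle n r k → Shuffle (suc n) r (suc k)

embL : ∀ {n r k} → Shuffle n r k → Fin r → Fin n
embL (left θ) fzero = fzero
embL (left θ) (fsuc j) = fsuc (embL θ j)
embL (right θ) j = fsuc (embL θ j)

embR : ∀ {n r k} → Shuffle n r k → Fin k → Fin n
embR (left θ) j = fsuc (embR θ j)
embR (right θ) fzero = fzero
embR (right θ) (fsuc j) = fsuc (embR θ j)

split : ∀ {n r k} → Shuffle n r k → Fin n → Fin r ⊎ Fin k
split (left θ) fzero = inj₁ fzero
split (left θ) (fsuc i) = map⊎ fsuc id (split θ i)
split (right θ) fzero = inj₂ fzero
split (right θ) (fsuc i) = map⊎ id fsuc (split θ i)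

join : ∀ {n r k} → Shuffle n r k → Fin r ⊎ Fin k → Fin n
join θ = case⊎ (embL θ) (embR θ)

split-embL : ∀ {n r k} (θ : Shuffle n r k) j → split θ (embL θ j) ≡ inj₁ j
split-embL (left θ) fzero = refl
split-embL (left θ) (fsuc j) rewrite split-embL θ j = refl
split-embL (right θ) j rewrite split-embL θ j = refl

split-embR : ∀ {n r k} (θ : Shuffle n r k) j → split θ (embR θ j) ≡ inj₂ j
split-embR (right θ) fzero = refl
split-embR (right θ) (fsuc j) rewrite split-embR θ j = refl
split-embR (left θ) j rewrite split-embR θ j = refl

join-split : ∀ {n r k} (θ : Shuffle n r k) i → join θ (split θ i) ≡ i
join-split (left θ) fzero = refl
join-split (left θ) (fsuc i) with split θ i | join-split θ i
... | inj₁ j | e = cong fsuc e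
... | inj₂ j | e = cong fsuc e
join-split (right θ) fzero = refl
join-split (right θ) (fsuc i) with split θ i | join-split θ i
... | inj₁ j | e = cong fsuc e
... | inj₂ j | e = cong fsuc e

data View {n r k} (θ : Shuffle n r k) : Fin n → Set where
  isL : ∀ j → View θ (embL θ j)
  isR : ∀ j → View θ (embR θ j)

view : ∀ {n r k} (θ : Shuffle n r k) i → View θ i
view θ i with split θ i | join-split θ i
... | inj₁ j | refl = isL j
... | inj₂ j | refl = isR j

embL-inj : ∀ {n r k} (θ : Shuffle n r k) {a b} → embL θ a ≡ embL θ b → a ≡ b
embL-inj θ {a} {b} e = inj₁-injective (trans (sym (split-embL θ a)) (trans (cong (split θ) e) (split-embL θ b)))

embR-inj : ∀ {n r k} (θ : Shuffle n r k) {a b} → embR θ a ≡ embR θ b → a ≡ b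
embR-inj θ {a} {b} e = inj₂-injective (trans (sym (split-embR θ a)) (trans (cong (split θ) e) (split-embR θ b)))

embL≢embR : ∀ {n r k} (θ : Shuffle n r k) a b → embL θ a ≢ embR θ b
embL≢embR θ a b e with trans (sym (split-embL θ a)) (trans (cong (split θ) e) (split-embR θ b))
... | ()

embL-< : ∀ {n r k} (θ : Shuffle n r k) a b → (toℕ (embL θ a) <ᵇ toℕ (embL θ b)) ≡ (toℕ a <ᵇ toℕ b)
embL-< (left θ) fzero fzero = refl
embL-< (left θ) fzero (fsuc b) = refl
embL-< (left θ) (fsuc a) fzero = refl
embL-< (left θ) (fsuc a) (fsuc b) = embL-< θ a b
embL-< (right θ) a b = embL-< θ a b

embR-< : ∀ {n r k} (θ : Shuffle n r k) a b → (toℕ (embR θ a) <ᵇ toℕ (embR θ b)) ≡ (toℕ a <ᵇ toℕ b)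
embR-< (right θ) fzero fzero = refl
embR-< (right θ) fzero (fsuc b) = refl
embR-< (right θ) (fsuc a) fzero = refl
embR-< (right θ) (fsuc a) (fsuc b) = embR-< θ a b
embR-< (left θ) a b = embR-< θ a b

≤ᵇ≡not<ᵇ : ∀ m n → (m ≤ᵇ n) ≡ not (n <ᵇ m)
≤ᵇ≡not<ᵇ zero    zero    = refl
≤ᵇ≡not<ᵇ zero    (suc n) = refl
≤ᵇ≡not<ᵇ (suc m) zero    = refl
≤ᵇ≡not<ᵇ (suc m) (suc n) = trans (sym (suc-≤ᵇ m n)) (≤ᵇ≡not<ᵇ m n)
  where
  suc-≤ᵇ : ∀ m n → (m ≤ᵇ n) ≡ (suc m ≤ᵇ suc n)
  suc-≤ᵇ zero    zero    = refl
  suc-≤ᵇ zero    (suc n) = refl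
  suc-≤ᵇ (suc m) n       = refl

embL-≤ : ∀ {n r k} (θ : Shuffle n r k) a b → (toℕ (embL θ a) ≤ᵇ toℕ (embL θ b)) ≡ (toℕ a ≤ᵇ toℕ b)
embL-≤ θ a b = trans (≤ᵇ≡not<ᵇ (toℕ (embL θ a)) (toℕ (embL θ b))) (trans (cong not (embL-< θ b a)) (sym (≤ᵇ≡not<ᵇ (toℕ a) (toℕ b))))

embR-≤ : ∀ {n r k} (θ : Shuffle n r k) a b → (toℕ (embR θ a) ≤ᵇ toℕ (embR θ b)) ≡ (toℕ a ≤ᵇ toℕ b)
embR-≤ θ a b = trans (≤ᵇ≡not<ᵇ (toℕ (embR θ a)) (toℕ (embR θ b))) (trans (cong not (embR-< θ b a)) (sym (≤ᵇ≡not<ᵇ (toℕ a) (toℕ b))))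

embL-= : ∀ {n r k} (θ : Shuffle n r k) a b → (embL θ a =F embL θ b) ≡ (a =F b)
embL-= θ a b with a =F b in e
... | true = =F-complete (cong (embL θ) (=F-sound e))
... | false = =F-false (λ h → true≢false (trans (sym (=F-complete (embL-inj θ h))) e))

embR-= : ∀ {n r k} (θ : Shuffle n r k) a b → (embR θ a =F embR θ b) ≡ (a =F b)
embR-= θ a b with a =F b in e
... | true = =F-complete (cong (embR θ) (=F-sound e))
... | false = =F-false (λ h → true≢false (trans (sym (=F-complete (embR-inj θ h))) e))

countB-allFin-shuffle : ∀ {n r k} (θ : Shuffle n r k) (P : Fin n → Bool) →
              countB P (allFin n) ≡ countB (P ∘ embL θ) (allFin r) + countB (P ∘ embR θ) (allFin k)
countB-allFin-shuffle done P = refl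
countB-allFin-shuffle {suc n} {suc r} {k} (left θ) P with P fzero
... | true = cong suc (trans (countB-tabulate P fsuc) (trans (countB-allFin-shuffle θ (P ∘ fsuc))
               (cong (_+ countB (P ∘ fsuc ∘ embR θ) (allFin k)) (sym (countB-tabulate (P ∘ embL (left θ)) fsuc)))))
... | false = trans (countB-tabulate P fsuc) (trans (countB-allFin-shuffle θ (P ∘ fsuc))
               (cong (_+ countB (P ∘ fsuc ∘ embR θ) (allFin k)) (sym (countB-tabulate (P ∘ embL (left θ)) fsuc))))
countB-allFin-shuffle {suc n} {r} {suc k} (right θ) P with P fzero
... | true = trans (cong suc (trans (countB-tabulate P fsuc) (trans (countB-allFin-shuffle θ (P ∘ fsuc))
               (cong (countB (P ∘ fsuc ∘ embL θ) (allFin r) +_) (sym (countB-tabulate (P ∘ embR (right θ)) fsuc))))))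
               (sym (+-suc _ _))
... | false = trans (countB-tabulate P fsuc) (trans (countB-allFin-shuffle θ (P ∘ fsuc))
               (cong (countB (P ∘ fsuc ∘ embL θ) (allFin r) +_) (sym (countB-tabulate (P ∘ embR (right θ)) fsuc))))

isLeft : ∀ {n r k} → Shuffle n r k → Fin n → Bool
isLeft θ i = case⊎ (λ _ → true) (λ _ → false) (split θ i)

isLeft-embL : ∀ {n r k} (θ : Shuffle n r k) j → isLeft θ (embL θ j) ≡ true
isLeft-embL θ j rewrite split-embL θ j = refl

isLeft-embR : ∀ {n r k} (θ : Shuffle n r k) j → isLeft θ (embR θ j) ≡ false
isLeft-embR θ j rewrite split-embR θ j = refl

isLeft-left : ∀ {n r k} (θ : Shuffle n r k) i → isLeft (left θ) (fsuc i) ≡ isLeft θ i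
isLeft-left θ i with split θ i
... | inj₁ _ = refl
... | inj₂ _ = refl

isLeft-right : ∀ {n r k} (θ : Shuffle n r k) i → isLeft (right θ) (fsuc i) ≡ isLeft θ i
isLeft-right θ i with split θ i
... | inj₁ _ = refl
... | inj₂ _ = refl

shuffle-size : ∀ {n r k} → Shuffle n r k → r + k ≡ n
shuffle-size done = refl
shuffle-size (left θ) = cong suc (shuffle-size θ)
shuffle-size {suc n} {r} {suc k} (right θ) = trans (+-suc r k) (cong suc (shuffle-size θ))

left-size≤ : ∀ {n r k} → Shuffle n r k → r ≤ n
left-size≤ {r = r} {k} θ = ≤-trans (m≤m+n r k) (≤-reflexive (shuffle-size θ))

right-size≤ : ∀ {n r k} → Shuffle n r k → k ≤ n
right-size≤ {r = r} {k} θ = ≤-trans (m≤n+m k r) (≤-reflexive (shuffle-size θ))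

snoc : ∀ {n r k} → Shuffle n r k → Shuffle (suc n) r (suc k)
snoc done = right done
snoc (left θ) = left (snoc θ)
snoc (right θ) = right (snoc θ)

snoc-last : ∀ {n r k} (θ : Shuffle n r k) → embR (snoc θ) (fromℕ k) ≡ fromℕ n
snoc-last done = refl
snoc-last (left θ) = cong fsuc (snoc-last θ)
snoc-last (right θ) = cong fsuc (snoc-last θ)

+-suc-injective : ∀ r {k n} → r + suc k ≡ suc n → r + k ≡ n
+-suc-injective r {k} e = suc-injective (trans (sym (+-suc r k)) e)

-- s is followed only as far as the sizes r and k allow; isLeft-fromIsLeft
-- shows that it is followed exactly when s has r true values.
fromIsLeft : ∀ n r k → r + k ≡ n → (Fin n → Bool) → Shuffle n r k
fromIsLeft zero zero zero e s = done
fromIsLeft zero (suc r) k ()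
fromIsLeft zero zero (suc k) ()
fromIsLeft (suc n) zero zero ()
fromIsLeft (suc n) zero (suc k) e s = right (fromIsLeft n zero k (suc-injective e) (s ∘ fsuc))
fromIsLeft (suc n) (suc r) zero e s = left (fromIsLeft n r zero (suc-injective e) (s ∘ fsuc))
fromIsLeft (suc n) (suc r) (suc k) e s with s fzero
... | true = left (fromIsLeft n r (suc k) (suc-injective e) (s ∘ fsuc))
... | false = right (fromIsLeft n (suc r) k (+-suc-injective (suc r) e) (s ∘ fsuc))

fromIsLeft-cong : ∀ n r k (e e' : r + k ≡ n) (s s' : Fin n → Bool) → (∀ i → s i ≡ s' i) → fromIsLeft n r k e s ≡ fromIsLeft n r k e' s'
fromIsLeft-cong zero zero zero e e' s s' h = refl
fromIsLeft-cong zero (suc r) k () e' s s' h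
fromIsLeft-cong zero zero (suc k) () e' s s' h
fromIsLeft-cong (suc n) zero zero () e' s s' h
fromIsLeft-cong (suc n) zero (suc k) e e' s s' h = cong right (fromIsLeft-cong n zero k _ _ _ _ (h ∘ fsuc))
fromIsLeft-cong (suc n) (suc r) zero e e' s s' h = cong left (fromIsLeft-cong n r zero _ _ _ _ (h ∘ fsuc))
fromIsLeft-cong (suc n) (suc r) (suc k) e e' s s' h with s fzero | s' fzero | h fzero
... | true | true | _ = cong left (fromIsLeft-cong n r (suc k) _ _ _ _ (h ∘ fsuc))
... | false | false | _ = cong right (fromIsLeft-cong n (suc r) k _ _ _ _ (h ∘ fsuc))

fromIsLeft-isLeft : ∀ {n r k} (θ : Shuffle n r k) (e : r + k ≡ n) → fromIsLeft n r k e (isLeft θ) ≡ θ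
fromIsLeft-isLeft done e = refl
fromIsLeft-isLeft {suc n} {suc r} {zero} (left θ) e =
  cong left (trans (fromIsLeft-cong n r zero _ _ _ _ (isLeft-left θ)) (fromIsLeft-isLeft θ (suc-injective e)))
fromIsLeft-isLeft {suc n} {suc r} {suc k} (left θ) e =
  cong left (trans (fromIsLeft-cong n r (suc k) _ _ _ _ (isLeft-left θ)) (fromIsLeft-isLeft θ (suc-injective e)))
fromIsLeft-isLeft {suc n} {zero} {suc k} (right θ) e =
  cong right (trans (fromIsLeft-cong n zero k _ _ _ _ (isLeft-right θ)) (fromIsLeft-isLeft θ (suc-injective e)))
fromIsLeft-isLeft {suc n} {suc r} {suc k} (right θ) e =
  cong right (trans (fromIsLeft-cong n (suc r) k _ _ _ _ (isLeft-right θ)) (fromIsLeft-isLeft θ (+-suc-injective (suc r) e)))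

isLeft-fromIsLeft : ∀ n r k (e : r + k ≡ n) (s : Fin n → Bool) → countB s (allFin n) ≡ r → ∀ i → isLeft (fromIsLeft n r k e s) i ≡ s i
isLeft-fromIsLeft zero zero zero e s c ()
isLeft-fromIsLeft zero (suc r) k () s c i
isLeft-fromIsLeft zero zero (suc k) () s c i
isLeft-fromIsLeft (suc n) zero zero () s c i
isLeft-fromIsLeft (suc n) zero (suc k) e s c i with s fzero in s0
... | true = ⊥-elim (0≢1+n (sym c))
isLeft-fromIsLeft (suc n) zero (suc k) e s c fzero | false = sym s0
isLeft-fromIsLeft (suc n) zero (suc k) e s c (fsuc i) | false =
  trans (isLeft-right (fromIsLeft n zero k (suc-injective e) (s ∘ fsuc)) i)
        (isLeft-fromIsLeft n zero k (suc-injective e) (s ∘ fsuc) (trans (sym (countB-tabulate s fsuc)) c) i)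
isLeft-fromIsLeft (suc n) (suc r) zero e s c i with s fzero in s0
isLeft-fromIsLeft (suc n) (suc r) zero e s c fzero | true = sym s0
isLeft-fromIsLeft (suc n) (suc r) zero e s c (fsuc i) | true =
  trans (isLeft-left (fromIsLeft n r zero (suc-injective e) (s ∘ fsuc)) i)
        (isLeft-fromIsLeft n r zero (suc-injective e) (s ∘ fsuc) (suc-injective (trans (cong suc (sym (countB-tabulate s fsuc))) c)) i)
... | false = ⊥-elim (<-irrefl refl (subst (_≤ n) (trans (trans (sym (countB-tabulate s fsuc)) c) (trans (sym (+-identityʳ (suc r))) e))
                                            (countB-allFin-≤ (s ∘ fsuc))))
isLeft-fromIsLeft (suc n) (suc r) (suc k) e s c i with s fzero in s0
isLeft-fromIsLeft (suc n) (suc r) (suc k) e s c fzero | true = sym s0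
isLeft-fromIsLeft (suc n) (suc r) (suc k) e s c (fsuc i) | true =
  trans (isLeft-left (fromIsLeft n r (suc k) (suc-injective e) (s ∘ fsuc)) i)
        (isLeft-fromIsLeft n r (suc k) (suc-injective e) (s ∘ fsuc) (suc-injective (trans (cong suc (sym (countB-tabulate s fsuc))) c)) i)
isLeft-fromIsLeft (suc n) (suc r) (suc k) e s c fzero | false = sym s0
isLeft-fromIsLeft (suc n) (suc r) (suc k) e s c (fsuc i) | false =
  trans (isLeft-right (fromIsLeft n (suc r) k (+-suc-injective (suc r) e) (s ∘ fsuc)) i)
        (isLeft-fromIsLeft n (suc r) k (+-suc-injective (suc r) e) (s ∘ fsuc) (trans (sym (countB-tabulate s fsuc)) c) i)

inject₁-or-last : ∀ {n} (i : Fin (suc n)) → (∃ λ i' → i ≡ inject₁ i') ⊎ i ≡ fromℕ n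
inject₁-or-last {zero} fzero = inj₂ refl
inject₁-or-last {suc n} fzero = inj₁ (fzero , refl)
inject₁-or-last {suc n} (fsuc i) with inject₁-or-last i
... | inj₁ (i' , e) = inj₁ (fsuc i' , cong fsuc e)
... | inj₂ e = inj₂ (cong fsuc e)

isLeft-snoc-inject₁ : ∀ {n r k} (θ : Shuffle n r k) i → isLeft (snoc θ) (inject₁ i) ≡ isLeft θ i
isLeft-snoc-inject₁ (left θ) fzero = refl
isLeft-snoc-inject₁ (left θ) (fsuc i) = trans (isLeft-left (snoc θ) (inject₁ i)) (trans (isLeft-snoc-inject₁ θ i) (sym (isLeft-left θ i)))
isLeft-snoc-inject₁ (right θ) fzero = refl
isLeft-snoc-inject₁ (right θ) (fsuc i) = trans (isLeft-right (snoc θ) (inject₁ i)) (trans (isLeft-snoc-inject₁ θ i) (sym (isLeft-right θ i)))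

isLeft-snoc-last : ∀ {n r k} (θ : Shuffle n r k) → isLeft (snoc θ) (fromℕ n) ≡ false
isLeft-snoc-last θ = trans (cong (isLeft (snoc θ)) (sym (snoc-last θ))) (isLeft-embR (snoc θ) _)

allShuffles : ∀ n r k → List (Shuffle n r k)
allShuffles zero zero zero = [ done ]
allShuffles zero (suc r) k = []
allShuffles zero zero (suc k) = []
allShuffles (suc n) zero zero = []
allShuffles (suc n) (suc r) zero = map left (allShuffles n r zero)
allShuffles (suc n) zero (suc k) = map right (allShuffles n zero k)
allShuffles (suc n) (suc r) (suc k) = map left (allShuffles n r (suc k)) ++ map right (allShuffles n (suc r) k)

_==ˢ_ : ∀ {n r k} → Shuffle n r k → Shuffle n r k → Bool
done ==ˢ done = true
(left a) ==ˢ (left b) = a ==ˢ b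
(right a) ==ˢ (right b) = a ==ˢ b
(left a) ==ˢ (right b) = false
(right a) ==ˢ (left b) = false

==ˢ-sound : ∀ {n r k} {a b : Shuffle n r k} → a ==ˢ b ≡ true → a ≡ b
==ˢ-sound {a = done} {done} h = refl
==ˢ-sound {a = left a} {left b} h = cong left (==ˢ-sound h)
==ˢ-sound {a = right a} {right b} h = cong right (==ˢ-sound h)

==ˢ-refl : ∀ {n r k} (a : Shuffle n r k) → a ==ˢ a ≡ true
==ˢ-refl done = refl
==ˢ-refl (left a) = ==ˢ-refl a
==ˢ-refl (right a) = ==ˢ-refl a

==ˢ-complete : ∀ {n r k} {a b : Shuffle n r k} → a ≡ b → a ==ˢ b ≡ true
==ˢ-complete {a = a} refl = ==ˢ-refl a

allShuffles-unique : ∀ {n r k} (θ : Shuffle n r k) → countB (θ ==ˢ_) (allShuffles n r k) ≡ 1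
allShuffles-unique done = refl
allShuffles-unique {suc n} {suc r} {zero} (left θ) = trans (countB-map (left θ ==ˢ_) left (allShuffles n r zero)) (allShuffles-unique θ)
allShuffles-unique {suc n} {suc r} {suc k} (left θ) =
  trans (countB-++ (left θ ==ˢ_) (map left (allShuffles n r (suc k))) (map right (allShuffles n (suc r) k)))
  (cong₂ _+_ (trans (countB-map (left θ ==ˢ_) left (allShuffles n r (suc k))) (allShuffles-unique θ))
             (trans (countB-map (left θ ==ˢ_) right (allShuffles n (suc r) k)) (countB-none _ (allShuffles n (suc r) k) (λ _ → refl))))
allShuffles-unique {suc n} {zero} {suc k} (right θ) = trans (countB-map (right θ ==ˢ_) right (allShuffles n zero k)) (allShuffles-unique θ)
allShuffles-unique {suc n} {suc r} {suc k} (right θ) =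
  trans (countB-++ (right θ ==ˢ_) (map left (allShuffles n r (suc k))) (map right (allShuffles n (suc r) k)))
  (cong₂ _+_ (trans (countB-map (right θ ==ˢ_) left (allShuffles n r (suc k))) (countB-none _ (allShuffles n r (suc k)) (λ _ → refl)))
             (trans (countB-map (right θ ==ˢ_) right (allShuffles n (suc r) k)) (allShuffles-unique θ)))

length-allShuffles : ∀ n r k → r + k ≡ n → length (allShuffles n r k) ≡ n C k
length-allShuffles zero zero zero e = refl
length-allShuffles zero (suc r) k ()
length-allShuffles zero zero (suc k) ()
length-allShuffles (suc n) zero zero ()
length-allShuffles (suc n) (suc r) zero e = trans (length-map left (allShuffles n r zero)) (length-allShuffles n r zero (suc-injective e))
length-allShuffles (suc n) zero (suc k) e with suc-injective e
... | refl = trans (length-map right (allShuffles n zero n)) (trans (length-allShuffles n zero n refl) (trans (nCn≡1 n) (sym (nCn≡1 (suc n)))))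
length-allShuffles (suc n) (suc r) (suc k) e =
  trans (length-++ (map left (allShuffles n r (suc k))))
  (trans (cong₂ _+_ (trans (length-map left (allShuffles n r (suc k))) (length-allShuffles n r (suc k) (suc-injective e)))
                    (trans (length-map right (allShuffles n (suc r) k)) (length-allShuffles n (suc r) k (+-suc-injective (suc r) e))))
  (trans (+-comm (n C suc k) (n C k)) (nCk+nC[k+1]≡[n+1]C[k+1] n k)))

shuffles : ∀ n r k → Enumeration (Shuffle n r k)
shuffles n r k = record
  { _≈ᵇ_     = _==ˢ_
  ; ≈ᵇ-refl  = ==ˢ-refl
  ; ≈ᵇ-sym   = λ {a} {b} h → ==ˢ-complete (sym (==ˢ-sound {a = a} {b} h))
  ; ≈ᵇ-trans = λ {a} {b} {d} h h' → ==ˢ-complete (trans (==ˢ-sound {a = a} {b} h) (==ˢ-sound {a = b} {d} h'))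
  ; elements = allShuffles n r k
  ; unique   = allShuffles-unique
  }

glue : ∀ {n r k} → Shuffle n r k → (Fin r → Fin r) → (Fin k → Fin k) → Fin n → Fin n
glue θ τ ρ i = join θ (map⊎ τ ρ (split θ i))

glue-L : ∀ {n r k} (θ : Shuffle n r k) τ ρ j → glue θ τ ρ (embL θ j) ≡ embL θ (τ j)
glue-L θ τ ρ j rewrite split-embL θ j = refl

glue-R : ∀ {n r k} (θ : Shuffle n r k) τ ρ j → glue θ τ ρ (embR θ j) ≡ embR θ (ρ j)
glue-R θ τ ρ j rewrite split-embR θ j = refl

iter-glue-L : ∀ {n r k} (θ : Shuffle n r k) τ ρ t j → iter (glue θ τ ρ) t (embL θ j) ≡ embL θ (iter τ t j)
iter-glue-L θ τ ρ zero j = refl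
iter-glue-L θ τ ρ (suc t) j = trans (cong (glue θ τ ρ) (iter-glue-L θ τ ρ t j)) (glue-L θ τ ρ _)

iter-glue-R : ∀ {n r k} (θ : Shuffle n r k) τ ρ t j → iter (glue θ τ ρ) t (embR θ j) ≡ embR θ (iter ρ t j)
iter-glue-R θ τ ρ zero j = refl
iter-glue-R θ τ ρ (suc t) j = trans (cong (glue θ τ ρ) (iter-glue-R θ τ ρ t j)) (glue-R θ τ ρ _)

glue-inj : ∀ {n r k} (θ : Shuffle n r k) τ ρ → Injective _≡_ _≡_ τ → Injective _≡_ _≡_ ρ → Injective _≡_ _≡_ (glue θ τ ρ)
glue-inj θ τ ρ iτ iρ {i} {i'} e with view θ i | view θ i'
... | isL a | isL b = cong (embL θ) (iτ (embL-inj θ (trans (sym (glue-L θ τ ρ a)) (trans e (glue-L θ τ ρ b)))))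
... | isR a | isR b = cong (embR θ) (iρ (embR-inj θ (trans (sym (glue-R θ τ ρ a)) (trans e (glue-R θ τ ρ b)))))
... | isL a | isR b = ⊥-elim (embL≢embR θ (τ a) (ρ b) (trans (sym (glue-L θ τ ρ a)) (trans e (glue-R θ τ ρ b))))
... | isR a | isL b = ⊥-elim (embL≢embR θ (τ b) (ρ a) (sym (trans (sym (glue-R θ τ ρ a)) (trans e (glue-L θ τ ρ b)))))

exc-glue : ∀ {n r k} (θ : Shuffle n r k) τ ρ → exc (glue θ τ ρ) ≡ exc τ + exc ρ
exc-glue {n} {r} {k} θ τ ρ = trans (countB-allFin-shuffle θ _) (cong₂ _+_
  (countB-cong (allFin r) (λ j → trans (cong (λ x → toℕ (embL θ j) <ᵇ toℕ x) (glue-L θ τ ρ j)) (embL-< θ j (τ j))))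
  (countB-cong (allFin k) (λ j → trans (cong (λ x → toℕ (embR θ j) <ᵇ toℕ x) (glue-R θ τ ρ j)) (embR-< θ j (ρ j)))))

fix-glue : ∀ {n r k} (θ : Shuffle n r k) τ ρ → fix (glue θ τ ρ) ≡ fix τ + fix ρ
fix-glue {n} {r} {k} θ τ ρ = trans (countB-allFin-shuffle θ _) (cong₂ _+_
  (countB-cong (allFin r) (λ j → trans (cong (λ x → x =F embL θ j) (glue-L θ τ ρ j)) (embL-= θ (τ j) j)))
  (countB-cong (allFin k) (λ j → trans (cong (λ x → x =F embR θ j) (glue-R θ τ ρ j)) (embR-= θ (ρ j) j))))

-- cyc scans n iterates of each point, but a point of Fin r has at most r
-- distinct iterates (allB-iterates-upTo-≥).
cyc-glue : ∀ {n r k} (θ : Shuffle n r k) τ ρ → Injective _≡_ _≡_ τ → Injective _≡_ _≡_ ρ → cyc (glue θ τ ρ) ≡ cyc τ + cyc ρ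
cyc-glue {n} {r} {k} θ τ ρ iτ iρ = trans (countB-allFin-shuffle θ _) (cong₂ _+_
  (countB-cong (allFin r) (λ j → trans (allB-cong (upTo n) (λ t → trans (cong (λ x → toℕ (embL θ j) ≤ᵇ toℕ x) (iter-glue-L θ τ ρ t j)) (embL-≤ θ j _)))
                                        (allB-iterates-upTo-≥ τ iτ (λ x → toℕ j ≤ᵇ toℕ x) j n (left-size≤ θ))))
  (countB-cong (allFin k) (λ j → trans (allB-cong (upTo n) (λ t → trans (cong (λ x → toℕ (embR θ j) ≤ᵇ toℕ x) (iter-glue-R θ τ ρ t j)) (embR-≤ θ j _)))
                                        (allB-iterates-upTo-≥ ρ iρ (λ x → toℕ j ≤ᵇ toℕ x) j n (right-size≤ θ)))))

glue-cong : ∀ {n r k} (θ : Shuffle n r k) {τ τ' : Fin r → Fin r} (ρ : Fin k → Fin k) → (∀ j → τ j ≡ τ' j) → ∀ i → glue θ τ ρ i ≡ glue θ τ' ρ i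
glue-cong θ ρ h i with split θ i
... | inj₁ j = cong (embL θ) (h j)
... | inj₂ c = refl

-- The cycle (0 1 ⋯ k) on Fin (suc k)

rot : ∀ {k} → Fin (suc k) → Fin (suc k)
rot {k} i with toℕ i <? k
... | yes i<k = fromℕ< (s≤s i<k)
... | no  _   = fzero

toℕ≤pred : ∀ {k} (i : Fin (suc k)) → toℕ i ≤ k
toℕ≤pred i = s≤s⁻¹ (toℕ<n i)

rot-cases : ∀ {k} (i : Fin (suc k)) → (toℕ i < k × toℕ (rot i) ≡ suc (toℕ i)) ⊎ (toℕ i ≡ k × rot i ≡ fzero)
rot-cases {k} i with toℕ i <? k
... | yes i<k = inj₁ (i<k , toℕ-fromℕ< (s≤s i<k))
... | no  i≮k = inj₂ (≤-antisym (toℕ≤pred i) (≮⇒≥ i≮k) , refl)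

rot-last : ∀ k → rot (fromℕ k) ≡ fzero
rot-last k with rot-cases (fromℕ k)
... | inj₁ (lt , _) = ⊥-elim (<-irrefl (toℕ-fromℕ k) lt)
... | inj₂ (_ , e)  = e

rot-increasing : ∀ {k} (c : Fin (suc k)) → toℕ c ≢ k → toℕ c < toℕ (rot c)
rot-increasing c c≢k with rot-cases c
... | inj₁ (_ , e)   = ≤-reflexive (sym e)
... | inj₂ (c≡k , _) = ⊥-elim (c≢k c≡k)

rot-inj : ∀ {k} → Injective _≡_ _≡_ (rot {k})
rot-inj {k} {a} {b} e with rot-cases a | rot-cases b
... | inj₁ (_ , ea) | inj₁ (_ , eb) = toℕ-injective (suc-injective (trans (sym ea) (trans (cong toℕ e) eb)))
... | inj₁ (_ , ea) | inj₂ (_ , eb) = ⊥-elim (0≢1+n (trans (sym (cong toℕ eb)) (trans (sym (cong toℕ e)) ea)))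
... | inj₂ (_ , ea) | inj₁ (_ , eb) = ⊥-elim (0≢1+n (trans (sym (cong toℕ ea)) (trans (cong toℕ e) eb)))
... | inj₂ (ka , _) | inj₂ (kb , _) = toℕ-injective (trans ka (sym kb))

iter-rot : ∀ {k} t (c : Fin (suc k)) → toℕ c + t ≤ k → toℕ (iter rot t c) ≡ toℕ c + t
iter-rot zero c _ = sym (+-identityʳ _)
iter-rot {k} (suc t) c c+t<k with rot-cases (iter rot t c) | iter-rot t c (<⇒≤ c+t<k′)
  where
  c+t<k′ : toℕ c + t < k
  c+t<k′ = ≤-trans (≤-reflexive (sym (+-suc (toℕ c) t))) c+t<k
... | inj₁ (_ , e)   | ih = trans e (trans (cong suc ih) (sym (+-suc (toℕ c) t)))
... | inj₂ (eq , _)  | ih = ⊥-elim (<-irrefl (trans (sym ih) eq) (≤-trans (≤-reflexive (sym (+-suc (toℕ c) t))) c+t<k))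

iter-rot-last : ∀ k t → t ≤ k → toℕ (iter rot (suc t) (fromℕ k)) ≡ t
iter-rot-last k t t≤k = begin
  toℕ (iter rot (suc t) (fromℕ k)) ≡⟨ cong toℕ (iter-sucʳ rot t (fromℕ k)) ⟩
  toℕ (iter rot t (rot (fromℕ k))) ≡⟨ cong (λ x → toℕ (iter rot t x)) (rot-last k) ⟩
  toℕ (iter rot t fzero)           ≡⟨ iter-rot t fzero t≤k ⟩
  t                                ∎
  where
  open ≡-Reasoning

iter-rot-wraps : ∀ {k} (c : Fin (suc k)) → iter rot (suc (k ∸ toℕ c)) c ≡ fzero
iter-rot-wraps {k} c with rot-cases (iter rot (k ∸ toℕ c) c)
... | inj₁ (lt , _) = ⊥-elim (<-irrefl reaches-k lt)
  where
  reaches-k : toℕ (iter rot (k ∸ toℕ c) c) ≡ k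
  reaches-k = trans (iter-rot (k ∸ toℕ c) c (≤-reflexive (m+[n∸m]≡n (toℕ≤pred c)))) (m+[n∸m]≡n (toℕ≤pred c))
... | inj₂ (_ , e) = e

countB-allFin-<ᵇ : ∀ m n → m ≤ n → countB (λ (i : Fin n) → toℕ i <ᵇ m) (allFin n) ≡ m
countB-allFin-<ᵇ zero    n       _         = countB-none _ (allFin n) (λ i → refl)
countB-allFin-<ᵇ (suc m) (suc n) (s≤s m≤n) =
  cong suc (trans (countB-tabulate {n = n} (λ i → toℕ i <ᵇ suc m) fsuc) (countB-allFin-<ᵇ m n m≤n))

exc-rot : ∀ k → exc (rot {k}) ≡ k
exc-rot k = trans (countB-cong (allFin (suc k)) exceeds-iff-below) (countB-allFin-<ᵇ k (suc k) (n≤1+n k))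
  where
  exceeds-iff-below : ∀ i → (toℕ i <ᵇ toℕ (rot i)) ≡ (toℕ i <ᵇ k)
  exceeds-iff-below i with rot-cases i
  ... | inj₁ (lt , e) = trans (cong (toℕ i <ᵇ_) e) (trans (<ᵇ-complete (n<1+n (toℕ i))) (sym (<ᵇ-complete lt)))
  ... | inj₂ (eq , e) = trans (cong (λ x → toℕ i <ᵇ toℕ x) e) (sym (<ᵇ-false (<-irrefl eq)))

fix-rot-suc : ∀ k → fix (rot {suc k}) ≡ 0
fix-rot-suc k = countB-none _ (allFin (suc (suc k))) moved
  where
  moved : ∀ i → (rot i =F i) ≡ false
  moved i with rot-cases i
  ... | inj₁ (_ , e)  = ≡ᵇ-false (λ h → <-irrefl (sym (trans (sym e) h)) (n<1+n (toℕ i)))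
  ... | inj₂ (eq , e) = ≡ᵇ-false (λ h → 0≢1+n (trans (sym (cong toℕ e)) (trans h eq)))

cyc-rot : ∀ k → cyc (rot {k}) ≡ 1
cyc-rot k = trans (countB-head cycleMinimum (tabulate fsuc) {fzero} zero-is-minimum)
                  (cong suc (trans (countB-tabulate {n = k} cycleMinimum fsuc) (countB-none _ (allFin k) not-minimum)))
  where
  cycleMinimum : Fin (suc k) → Bool
  cycleMinimum i = allB (λ j → toℕ i ≤ᵇ toℕ (iter rot j i)) (upTo (suc k))

  zero-is-minimum : cycleMinimum fzero ≡ true
  zero-is-minimum = allB-applyUpTo⁺ _ id (suc k) (λ _ _ → refl)

  not-minimum : ∀ i → cycleMinimum (fsuc i) ≡ false
  not-minimum i = ≢true⇒≡false λ h → true≢false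
    (trans (sym (allB-applyUpTo⁻ _ id (suc k) h (suc (k ∸ toℕ c)) wrap<)) (cong (λ x → toℕ c ≤ᵇ toℕ x) (iter-rot-wraps c)))
    where
    c : Fin (suc k)
    c = fsuc i
    wrap< : suc (k ∸ toℕ c) < suc k
    wrap< = s≤s (∸-monoʳ-< {k} {toℕ c} {0} z<s (toℕ≤pred c))

inOrbitOfLast : ∀ {n} → (Fin (suc n) → Fin (suc n)) → Fin (suc n) → Bool
inOrbitOfLast {n} σ i = anyB (λ j → iter σ j (lastF n) =F i) (upTo (suc n))

fcyc≡suc : ∀ {n} (σ : Fin (suc n) → Fin (suc n)) → fcyc σ ≡ suc (countB (inOrbitOfLast σ ∘ inject₁) (allFin n))
fcyc≡suc {n} σ = begin
  fcyc σ                                                   ≡⟨ countB-allFin-last (inOrbitOfLast σ) ⟩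
  c₀ + (if inOrbitOfLast σ (fromℕ n) then 1 else 0)        ≡⟨ cong (λ b → c₀ + (if b then 1 else 0)) last-in-orbit ⟩
  c₀ + 1                                                   ≡⟨ +-comm c₀ 1 ⟩
  suc c₀                                                   ∎
  where
  open ≡-Reasoning
  c₀ : ℕ
  c₀ = countB (inOrbitOfLast σ ∘ inject₁) (allFin n)
  last-in-orbit : inOrbitOfLast σ (fromℕ n) ≡ true
  last-in-orbit = anyB-applyUpTo⁺ _ id (suc n) 0 z<s (=F-refl (fromℕ n))

-- τ acts on the left positions of θ; the right positions c₁ < ⋯ < c_k
-- of θ together with the last point m form the cycle (c₁ … c_k m).
assemble : ∀ {n r k} → Shuffle n r k → (Fin r → Fin r) → Fin (suc n) → Fin (suc n)
assemble θ τ = glue (snoc θ) τ rot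

module _ {n r k} (θ : Shuffle n r k) (τ : Fin r → Fin r) where
  private
    θ⁺ : Shuffle (suc n) r (suc k)
    θ⁺ = snoc θ
    σ : Fin (suc n) → Fin (suc n)
    σ = assemble θ τ
    m : Fin (suc n)
    m = lastF n

  iter-assemble-last : ∀ t → iter σ t m ≡ embR θ⁺ (iter rot t (fromℕ k))
  iter-assemble-last t = trans (cong (iter σ t) (sym (snoc-last θ))) (iter-glue-R θ⁺ τ rot t (fromℕ k))

  assemble-isPerm : Injective _≡_ _≡_ τ → isPerm σ ≡ true
  assemble-isPerm iτ = isPerm-complete σ (glue-inj θ⁺ τ rot iτ rot-inj)

  assemble-exc : exc σ ≡ exc τ + k
  assemble-exc = trans (exc-glue θ⁺ τ rot) (cong (exc τ +_) (exc-rot k))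

  assemble-fix : fix σ ≡ fix τ + fix (rot {k})
  assemble-fix = fix-glue θ⁺ τ rot

  assemble-cyc : Injective _≡_ _≡_ τ → cyc σ ≡ cyc τ + 1
  assemble-cyc iτ = trans (cyc-glue θ⁺ τ rot iτ rot-inj) (cong (cyc τ +_) (cyc-rot k))

  left-not-in-orbit : ∀ j → inOrbitOfLast σ (embL θ⁺ j) ≡ false
  left-not-in-orbit j = ≢true⇒≡false λ h → case anyB-applyUpTo⁻ _ id (suc n) h of λ
    { (t , _ , e) → embL≢embR θ⁺ j _ (sym (trans (sym (iter-assemble-last t)) (=F-sound e))) }

  right-in-orbit : ∀ c → inOrbitOfLast σ (embR θ⁺ c) ≡ true
  right-in-orbit c with toℕ c ≟ k
  ... | yes c≡k = anyB-applyUpTo⁺ _ id (suc n) 0 z<s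
                    (=F-complete (trans (sym (snoc-last θ)) (cong (embR θ⁺) (toℕ-injective (trans (toℕ-fromℕ k) (sym c≡k))))))
  ... | no  c≢k = anyB-applyUpTo⁺ _ id (suc n) (suc (toℕ c)) (s≤s (≤-trans c<k (right-size≤ θ)))
                    (=F-complete (trans (iter-assemble-last (suc (toℕ c))) (cong (embR θ⁺) (toℕ-injective (iter-rot-last k (toℕ c) (toℕ≤pred c))))))
    where
    c<k : toℕ c < k
    c<k = ≤∧≢⇒< (toℕ≤pred c) c≢k

  inOrbitOfLast-assemble : ∀ x → inOrbitOfLast σ x ≡ not (isLeft θ⁺ x)
  inOrbitOfLast-assemble x with view θ⁺ x
  ... | isL j = trans (left-not-in-orbit j) (cong not (sym (isLeft-embL θ⁺ j)))
  ... | isR c = trans (right-in-orbit c) (cong not (sym (isLeft-embR θ⁺ c)))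

  assemble-fcyc : fcyc σ ≡ suc k
  assemble-fcyc = trans (countB-allFin-shuffle θ⁺ _) (cong₂ _+_
    (countB-none _ (allFin r) left-not-in-orbit)
    (trans (countB-all _ (allFin (suc k)) right-in-orbit) (length-tabulate id)))

  assemble-inQhat : inQhat σ ≡ true
  assemble-inQhat = allB-applyUpTo⁺ _ id n (λ j _ → step j)
    where
    step : ∀ j → ((iter σ (suc j) m =F m) ∨ (iter σ (suc (suc j)) m =F m) ∨ (toℕ (iter σ (suc j) m) <ᵇ toℕ (iter σ (suc (suc j)) m))) ≡ true
    step j with toℕ (iter rot (suc j) (fromℕ k)) ≟ k
    ... | yes c≡k = ∨-introˡ (=F-complete (trans (iter-assemble-last (suc j))
                      (trans (cong (embR θ⁺) (toℕ-injective (trans c≡k (sym (toℕ-fromℕ k))))) (snoc-last θ))))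
    ... | no  c≢k = ∨-introʳ (iter σ (suc j) m =F m) (∨-introʳ (iter σ (suc (suc j)) m =F m)
                      (trans (cong₂ (λ a b → toℕ a <ᵇ toℕ b) (iter-assemble-last (suc j)) (iter-assemble-last (suc (suc j))))
                             (trans (embR-< θ⁺ c (rot c)) (<ᵇ-complete (rot-increasing c c≢k)))))
      where
      c : Fin (suc k)
      c = iter rot (suc j) (fromℕ k)

StrictlyIncreasing : ∀ {L} → (Fin L → ℕ) → Set
StrictlyIncreasing f = ∀ a b → toℕ a < toℕ b → f a < f b

pred-strictlyIncreasing : ∀ {L} (f : Fin L → ℕ) → (∀ c → 0 < f c) → StrictlyIncreasing f → StrictlyIncreasing (pred ∘ f)
pred-strictlyIncreasing f pos mono a b a<b = pred-mono-< {{>-nonZero (pos a)}} (mono a b a<b)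

increasing-enumeration-embR :
  ∀ {N r K} L (θ : Shuffle N r K) (f : Fin L → ℕ) → StrictlyIncreasing f →
  (∀ c → ∃ λ i → isLeft θ i ≡ false × f c ≡ toℕ i) →
  (∀ i → isLeft θ i ≡ false → ∃ λ c → f c ≡ toℕ i) →
  Σ (L ≡ K) λ eq → ∀ c → toℕ (embR θ (subst Fin eq c)) ≡ f c
increasing-enumeration-embR zero done f mono into onto = refl , λ ()
increasing-enumeration-embR (suc L) done f mono into onto with into fzero
... | () , _
increasing-enumeration-embR L (left θ) f mono into onto
  with increasing-enumeration-embR L θ (pred ∘ f) (pred-strictlyIncreasing f pos mono) into′ onto′
  where
  pos : ∀ c → 0 < f c
  pos c with into c
  ... | fzero  , e , _ = ⊥-elim (true≢false e)
  ... | fsuc i , _ , e = subst (0 <_) (sym e) z<s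
  into′ : ∀ c → ∃ λ i → isLeft θ i ≡ false × pred (f c) ≡ toℕ i
  into′ c with into c
  ... | fzero  , e , _  = ⊥-elim (true≢false e)
  ... | fsuc i , e , e′ = i , trans (sym (isLeft-left θ i)) e , cong pred e′
  onto′ : ∀ i → isLeft θ i ≡ false → ∃ λ c → pred (f c) ≡ toℕ i
  onto′ i e with onto (fsuc i) (trans (isLeft-left θ i) e)
  ... | c , e′ = c , cong pred e′
... | refl , agree = refl , λ c → trans (cong suc (agree c)) (suc-pred (f c) {{>-nonZero (positive c)}})
  where
  positive : ∀ c → 0 < f c
  positive c with into c
  ... | fzero  , e , _ = ⊥-elim (true≢false e)
  ... | fsuc i , _ , e = subst (0 <_) (sym e) z<s
increasing-enumeration-embR zero (right θ) f mono into onto with onto fzero refl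
... | () , _
increasing-enumeration-embR (suc L) (right θ) f mono into onto
  with increasing-enumeration-embR L θ (pred ∘ f ∘ fsuc) (pred-strictlyIncreasing (f ∘ fsuc) pos (λ a b → mono (fsuc a) (fsuc b) ∘ s<s)) into′ onto′
  where
  f0≡0 : f fzero ≡ 0
  f0≡0 with onto fzero refl
  ... | fzero  , e = e
  ... | fsuc c , e = ⊥-elim (n≮0 (subst (f fzero <_) e (mono fzero (fsuc c) z<s)))
  pos : ∀ c → 0 < f (fsuc c)
  pos c = ≤-trans z<s (mono fzero (fsuc c) z<s)
  into′ : ∀ c → ∃ λ i → isLeft θ i ≡ false × pred (f (fsuc c)) ≡ toℕ i
  into′ c with into (fsuc c)
  ... | fzero  , e , e′ = ⊥-elim (<-irrefl (sym e′) (pos c))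
  ... | fsuc i , e , e′ = i , trans (sym (isLeft-right θ i)) e , cong pred e′
  onto′ : ∀ i → isLeft θ i ≡ false → ∃ λ c → pred (f (fsuc c)) ≡ toℕ i
  onto′ i e with onto (fsuc i) (trans (isLeft-right θ i) e)
  ... | fzero  , e′ = ⊥-elim (0≢1+n (trans (sym f0≡0) e′))
  ... | fsuc c , e′ = c , cong pred e′
... | refl , agree = refl , agree′
  where
  agree′ : ∀ c → toℕ (embR (right θ) c) ≡ f c
  agree′ fzero    with onto fzero refl
  ... | fzero  , e = sym e
  ... | fsuc c , e = ⊥-elim (n≮0 (subst (f fzero <_) e (mono fzero (fsuc c) z<s)))
  agree′ (fsuc c) = trans (cong suc (agree c)) (suc-pred (f (fsuc c)) {{>-nonZero (≤-trans z<s (mono fzero (fsuc c) z<s))}})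

isLeft⇒split-inj₁ : ∀ {n r k} (θ : Shuffle n r k) x → isLeft θ x ≡ true → ∃ λ b → split θ x ≡ inj₁ b
isLeft⇒split-inj₁ θ x h with split θ x
... | inj₁ b = b , refl
... | inj₂ _ = ⊥-elim (true≢false (sym h))

subst-Fin-sym : ∀ {A B} (eq : A ≡ B) (c : Fin B) → subst Fin eq (subst Fin (sym eq) c) ≡ c × toℕ (subst Fin (sym eq) c) ≡ toℕ c
subst-Fin-sym refl c = refl , refl

orbitShuffle : ∀ {n r k} → r + k ≡ n → (Fin (suc n) → Fin (suc n)) → Shuffle n r k
orbitShuffle {n} {r} {k} e σ = fromIsLeft n r k e (not ∘ inOrbitOfLast σ ∘ inject₁)

-- σ read on the left positions of θ; the value j on a right position is
-- junk, never reached when σ = assemble θ τ.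
leftPart : ∀ {n r k} → (Fin (suc n) → Fin (suc n)) → Shuffle n r k → Fin r → Fin r
leftPart σ θ j = case⊎ id (λ _ → j) (split (snoc θ) (σ (embL (snoc θ) j)))

module Decomposition {n r k} (e : r + k ≡ n) (σ : Fin (suc n) → Fin (suc n)) where
  m : Fin (suc n)
  m = lastF n

  orbit : ℕ → Fin (suc n)
  orbit t = iter σ t m

  θ : Shuffle n r k
  θ = orbitShuffle e σ

  θ⁺ : Shuffle (suc n) r (suc k)
  θ⁺ = snoc θ

  τ : Fin r → Fin r
  τ = leftPart σ θ

  last-inOrbitOfLast : inOrbitOfLast σ m ≡ true
  last-inOrbitOfLast = anyB-applyUpTo⁺ _ id (suc n) 0 z<s (=F-refl m)

  module _ (inj : Injective _≡_ _≡_ σ) (qhat : inQhat σ ≡ true) (fc : fcyc σ ≡ suc k) where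

    private
      O : Fin (suc n) → Bool
      O = inOrbitOfLast σ

    countB-orbit-below-last : countB (O ∘ inject₁) (allFin n) ≡ k
    countB-orbit-below-last = suc-injective (begin
      suc (countB (O ∘ inject₁) (allFin n))                     ≡⟨ +-comm 1 _ ⟩
      countB (O ∘ inject₁) (allFin n) + 1                       ≡⟨ cong (λ b → countB (O ∘ inject₁) (allFin n) + (if b then 1 else 0)) (sym last-inOrbitOfLast) ⟩
      countB (O ∘ inject₁) (allFin n) + (if O m then 1 else 0)  ≡⟨ sym (countB-allFin-last O) ⟩
      fcyc σ                                                    ≡⟨ fc ⟩
      suc k                                                     ∎)
      where
      open ≡-Reasoning

    countB-notInOrbit : countB (not ∘ O ∘ inject₁) (allFin n) ≡ r
    countB-notInOrbit = +-cancelʳ-≡ _ _ _ (trans (cong (countB (not ∘ O ∘ inject₁) (allFin n) +_) (sym countB-orbit-below-last))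
                                          (trans (countB-not (O ∘ inject₁) (allFin n)) (trans (length-tabulate id) (sym e))))

    isLeft-θ⁺ : ∀ i → isLeft θ⁺ i ≡ not (O i)
    isLeft-θ⁺ i with inject₁-or-last i
    ... | inj₁ (i' , refl) = trans (isLeft-snoc-inject₁ θ i') (isLeft-fromIsLeft n r k e _ countB-notInOrbit i')
    ... | inj₂ refl        = trans (isLeft-snoc-last θ) (cong not (sym last-inOrbitOfLast))

    -- L is the length of the cycle of m. The Q̂ condition makes orbit 1, …, orbit L
    -- increasing, so they enumerate the right positions of θ⁺, last one m.
    module _ (L : ℕ) (L>0 : 0 < L) (L≤ : L ≤ suc n) (returns : orbit L ≡ m) (first : ∀ t → 0 < t → t < L → orbit t ≢ m) where

      orbit-step-increasing : ∀ t → 0 < t → suc t < L → toℕ (orbit t) < toℕ (orbit (suc t))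
      orbit-step-increasing (suc j) _ lt with ∨-elim {orbit (suc j) =F m} (allB-applyUpTo⁻ _ id n qhat j j<n)
        where
        j<n : j < n
        j<n = ≤-trans (n≤1+n (suc j)) (s≤s⁻¹ (≤-trans lt L≤))
      ... | inj₁ h = ⊥-elim (first (suc j) z<s (≤-trans (n≤1+n _) lt) (=F-sound h))
      ... | inj₂ h with ∨-elim {orbit (suc (suc j)) =F m} h
      ... | inj₁ h' = ⊥-elim (first (suc (suc j)) z<s lt (=F-sound h'))
      ... | inj₂ h' = <ᵇ-sound h'

      orbit-increasing : ∀ t t' → 0 < t → t < t' → t' < L → toℕ (orbit t) < toℕ (orbit t')
      orbit-increasing t (suc t'') t>0 (s≤s t≤t'') lt with m≤n⇒m<n∨m≡n t≤t''
      ... | inj₂ refl  = orbit-step-increasing t t>0 lt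
      ... | inj₁ t<t'' = <-trans (orbit-increasing t t'' t>0 t<t'' (<-trans (n<1+n _) lt))
                                 (orbit-step-increasing t'' (≤-trans t>0 (<⇒≤ t<t'')) lt)

      orbit-below-last : ∀ t → 0 < t → t < L → toℕ (orbit t) < n
      orbit-below-last t t>0 t<L =
        ≤∧≢⇒< (s≤s⁻¹ (toℕ<n (orbit t))) (λ h → first t t>0 t<L (toℕ-injective (trans h (sym (toℕ-fromℕ n)))))

      cycleEnumeration : Fin L → ℕ
      cycleEnumeration c = toℕ (orbit (suc (toℕ c)))

      cycleEnumeration-increasing : StrictlyIncreasing cycleEnumeration
      cycleEnumeration-increasing c c' lt with m≤n⇒m<n∨m≡n (toℕ<n c')
      ... | inj₁ lt' = orbit-increasing (suc (toℕ c)) (suc (toℕ c')) z<s (s<s lt) lt'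
      ... | inj₂ eq' = subst (cycleEnumeration c <_) (sym (trans (cong (toℕ ∘ orbit) eq') (trans (cong toℕ returns) (toℕ-fromℕ n))))
                             (orbit-below-last (suc (toℕ c)) z<s (≤-trans (s<s lt) (≤-reflexive eq')))

      inOrbitOfLast-orbit : ∀ t → O (orbit t) ≡ true
      inOrbitOfLast-orbit t with iter-reduce σ m L L>0 returns t
      ... | t' , t'<L , eq = anyB-applyUpTo⁺ _ id (suc n) t' (≤-trans t'<L L≤) (=F-complete (sym eq))

      cycleEnumeration-right : ∀ c → ∃ λ i → isLeft θ⁺ i ≡ false × cycleEnumeration c ≡ toℕ i
      cycleEnumeration-right c = orbit (suc (toℕ c)) , trans (isLeft-θ⁺ _) (cong not (inOrbitOfLast-orbit (suc (toℕ c)))) , refl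

      right-cycleEnumeration : ∀ i → isLeft θ⁺ i ≡ false → ∃ λ c → cycleEnumeration c ≡ toℕ i
      right-cycleEnumeration i h with anyB-applyUpTo⁻ _ id (suc n) (not≡false⇒≡true (trans (sym (isLeft-θ⁺ i)) h))
      ... | t , _ , at with iter-reduce σ m L L>0 returns t
      ... | zero , _ , eq = fromℕ< L-1<L ,
            trans (cong (toℕ ∘ orbit ∘ suc) (toℕ-fromℕ< L-1<L)) (cong toℕ (trans (cong orbit (suc-pred L {{>-nonZero L>0}})) (trans returns (trans (sym eq) (=F-sound at)))))
        where
        L-1<L : pred L < L
        L-1<L = ≤-reflexive (suc-pred L {{>-nonZero L>0}})
      ... | suc c , c+1<L , eq = fromℕ< c<L , cong toℕ (trans (cong (orbit ∘ suc) (toℕ-fromℕ< c<L)) (trans (sym eq) (=F-sound at)))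
        where
        c<L : c < L
        c<L = <-trans (n<1+n c) c+1<L

      private
        enumeration : Σ (L ≡ suc k) λ eq → ∀ c → toℕ (embR θ⁺ (subst Fin eq c)) ≡ cycleEnumeration c
        enumeration = increasing-enumeration-embR L θ⁺ cycleEnumeration cycleEnumeration-increasing cycleEnumeration-right right-cycleEnumeration

      cycle-length : L ≡ suc k
      cycle-length = proj₁ enumeration

      embR-orbit : ∀ (c : Fin (suc k)) → embR θ⁺ c ≡ orbit (suc (toℕ c))
      embR-orbit c with subst-Fin-sym cycle-length c
      ... | e1 , e2 = toℕ-injective (trans (cong (toℕ ∘ embR θ⁺) (sym e1))
                                           (trans (proj₂ enumeration (subst Fin (sym cycle-length) c)) (cong (toℕ ∘ orbit ∘ suc) e2)))

      inOrbitOfLast-preimage : ∀ x → O (σ x) ≡ true → O x ≡ true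
      inOrbitOfLast-preimage x h with anyB-applyUpTo⁻ _ id (suc n) h
      ... | suc t , t< , at = anyB-applyUpTo⁺ _ id (suc n) t (<-trans (n<1+n t) t<) (=F-complete (inj (=F-sound at)))
      ... | zero  , _  , at = subst (λ y → O y ≡ true) (inj (trans before-m (=F-sound at))) (inOrbitOfLast-orbit (pred L))
        where
        before-m : σ (orbit (pred L)) ≡ m
        before-m = trans (cong orbit (suc-pred L {{>-nonZero L>0}})) returns

      assemble-right : ∀ c → embR θ⁺ (rot c) ≡ σ (embR θ⁺ c)
      assemble-right c with rot-cases c
      ... | inj₁ (_ , ec) = trans (embR-orbit (rot c)) (trans (cong (orbit ∘ suc) ec) (cong σ (sym (embR-orbit c))))
      ... | inj₂ (ck , ec) = trans (cong (embR θ⁺) ec) (trans (embR-orbit fzero)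
                               (cong σ (sym (trans (embR-orbit c) (trans (cong (orbit ∘ suc) ck) (trans (cong orbit (sym cycle-length)) returns))))))

      assemble-left : ∀ j → embL θ⁺ (τ j) ≡ σ (embL θ⁺ j)
      assemble-left j with isLeft⇒split-inj₁ θ⁺ (σ x) σx-left
        where
        x : Fin (suc n)
        x = embL θ⁺ j
        x-outside : O x ≡ false
        x-outside = not≡true⇒≡false (trans (sym (isLeft-θ⁺ x)) (isLeft-embL θ⁺ j))
        σx-left : isLeft θ⁺ (σ x) ≡ true
        σx-left = trans (isLeft-θ⁺ (σ x)) (cong not (≢true⇒≡false (λ h → true≢false (trans (sym (inOrbitOfLast-preimage x h)) x-outside))))
      ... | b , eqs = trans (cong (embL θ⁺ ∘ case⊎ id (λ _ → j)) eqs) (trans (sym (cong (join θ⁺) eqs)) (join-split θ⁺ (σ (embL θ⁺ j))))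

      assemble-decompose′ : ∀ i → assemble θ τ i ≡ σ i
      assemble-decompose′ i with view θ⁺ i
      ... | isR c = trans (glue-R θ⁺ τ rot c) (assemble-right c)
      ... | isL j = trans (glue-L θ⁺ τ rot j) (assemble-left j)

    assemble-decompose : ∀ i → assemble θ τ i ≡ σ i
    assemble-decompose with iter-minimal-return σ inj m
    ... | L , L>0 , L≤ , returns , first = assemble-decompose′ L L>0 L≤ returns first

    τ-injective : Injective _≡_ _≡_ τ
    τ-injective {j} {j'} h = embL-inj θ⁺ (inj (begin
      σ (embL θ⁺ j)      ≡⟨ sym (assemble-decompose _) ⟩
      assemble θ τ (embL θ⁺ j)  ≡⟨ glue-L θ⁺ τ rot j ⟩
      embL θ⁺ (τ j)      ≡⟨ cong (embL θ⁺) h ⟩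
      embL θ⁺ (τ j')     ≡⟨ sym (glue-L θ⁺ τ rot j') ⟩
      assemble θ τ (embL θ⁺ j') ≡⟨ assemble-decompose _ ⟩
      σ (embL θ⁺ j')     ∎))
      where
      open ≡-Reasoning

module _ {n} {σ σ' : Fin n → Fin n} (h : ∀ i → σ i ≡ σ' i) where
  exc-cong : exc σ ≡ exc σ'
  exc-cong = countB-cong (allFin n) (λ i → cong (λ x → toℕ i <ᵇ toℕ x) (h i))

  fix-cong : fix σ ≡ fix σ'
  fix-cong = countB-cong (allFin n) (λ i → cong (_=F i) (h i))

  cyc-cong : cyc σ ≡ cyc σ'
  cyc-cong = countB-cong (allFin n) (λ i → allB-cong (upTo n) (λ j → cong (λ x → toℕ i ≤ᵇ toℕ x) (iter-cong h j i)))

module _ {n} {σ σ' : Fin (suc n) → Fin (suc n)} (h : ∀ i → σ i ≡ σ' i) where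
  inOrbitOfLast-cong : ∀ i → inOrbitOfLast σ i ≡ inOrbitOfLast σ' i
  inOrbitOfLast-cong i = anyB-cong (upTo (suc n)) (λ j → cong (_=F i) (iter-cong h j (lastF n)))

  fcyc-cong : fcyc σ ≡ fcyc σ'
  fcyc-cong = countB-cong (allFin (suc n)) inOrbitOfLast-cong

  inQhat-cong : inQhat σ ≡ inQhat σ'
  inQhat-cong = allB-cong (upTo n) (λ j → cong₂ (λ a b → (a =F lastF n) ∨ (b =F lastF n) ∨ (toℕ a <ᵇ toℕ b))
                                                 (iter-cong h (suc j) (lastF n)) (iter-cong h (suc (suc j)) (lastF n)))

  orbitShuffle-cong : ∀ {r k} (e : r + k ≡ n) → orbitShuffle e σ ≡ orbitShuffle e σ'
  orbitShuffle-cong {r} {k} e = fromIsLeft-cong n r k e e _ _ (cong not ∘ inOrbitOfLast-cong ∘ inject₁)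

  leftPart-cong : ∀ {r k} (θ : Shuffle n r k) j → leftPart σ θ j ≡ leftPart σ' θ j
  leftPart-cong θ j = cong (λ x → case⊎ id (λ _ → j) (split (snoc θ) x)) (h _)

orbitShuffle-assemble : ∀ {n r k} (e : r + k ≡ n) (θ : Shuffle n r k) τ → orbitShuffle e (assemble θ τ) ≡ θ
orbitShuffle-assemble {n} {r} {k} e θ τ = trans (fromIsLeft-cong n r k e e _ _ outside-orbit-is-left) (fromIsLeft-isLeft θ e)
  where
  outside-orbit-is-left : ∀ i → not (inOrbitOfLast (assemble θ τ) (inject₁ i)) ≡ isLeft θ i
  outside-orbit-is-left i = trans (cong not (inOrbitOfLast-assemble θ τ (inject₁ i)))
                                  (trans (not-involutive _) (isLeft-snoc-inject₁ θ i))

leftPart-assemble : ∀ {n r k} (θ : Shuffle n r k) τ j → leftPart (assemble θ τ) θ j ≡ τ j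
leftPart-assemble θ τ j = cong (case⊎ id (λ _ → j)) (trans (cong (split (snoc θ)) (glue-L (snoc θ) τ rot j)) (split-embL (snoc θ) (τ j)))

inQhatWithFcyc : ∀ {n} → ℕ → (Fin (suc n) → Fin (suc n)) → Bool
inQhatWithFcyc k σ = (isPerm σ ∧ inQhat σ) ∧ (fcyc σ ≡ᵇ suc k)

inQhatWithFcyc-cong : ∀ {n} k {σ σ' : Fin (suc n) → Fin (suc n)} → (∀ i → σ i ≡ σ' i) → inQhatWithFcyc k σ ≡ inQhatWithFcyc k σ'
inQhatWithFcyc-cong k h = cong₂ _∧_ (cong₂ _∧_ (isPerm-cong h) (inQhat-cong h)) (cong (_≡ᵇ suc k) (fcyc-cong h))

countB-inQhatWithFcyc : ∀ {n} (σ : Fin (suc n) → Fin (suc n)) →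
                        countB (λ k → inQhatWithFcyc k σ) (upTo (suc n)) ≡ (if isPerm σ ∧ inQhat σ then 1 else 0)
countB-inQhatWithFcyc {n} σ with isPerm σ ∧ inQhat σ
... | false = countB-none _ (upTo (suc n)) (λ _ → refl)
... | true  = trans (countB-cong (upTo (suc n)) (λ k → cong (_≡ᵇ suc k) (fcyc≡suc σ)))
                    (countB-upTo-≡ᵇ (suc n) _ (s≤s (countB-allFin-≤ (inOrbitOfLast σ ∘ inject₁))))

module Correspondence {n r k} (e : r + k ≡ n) where

  decompose : (Fin (suc n) → Fin (suc n)) → Shuffle n r k × (Fin r → Fin r)
  decompose σ = orbitShuffle e σ , leftPart σ (orbitShuffle e σ)

  private
    hypotheses : ∀ (σ : Fin (suc n) → Fin (suc n)) → inQhatWithFcyc k σ ≡ true → Injective _≡_ _≡_ σ × inQhat σ ≡ true × fcyc σ ≡ suc k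
    hypotheses σ h = isPerm-sound σ (∧-elimˡ (∧-elimˡ h)) , ∧-elimʳ {isPerm σ} (∧-elimˡ h) , ≡ᵇ-sound (∧-elimʳ {isPerm σ ∧ inQhat σ} h)

  assemble-cong : ∀ {b b' : Shuffle n r k × (Fin r → Fin r)} →
                  ((proj₁ b ==ˢ proj₁ b') ∧ (proj₂ b ≗ᵇ proj₂ b')) ≡ true → (uncurry assemble b ≗ᵇ uncurry assemble b') ≡ true
  assemble-cong {θ , τ} {θ' , τ'} h with ==ˢ-sound {a = θ} {θ'} (∧-elimˡ h)
  ... | refl = ≗ᵇ-complete (glue-cong (snoc θ) rot (≗ᵇ-sound {f = τ} {τ'} (∧-elimʳ {θ ==ˢ θ'} h)))

  decompose-cong : ∀ {σ σ' : Fin (suc n) → Fin (suc n)} → (σ ≗ᵇ σ') ≡ true →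
                   ((proj₁ (decompose σ) ==ˢ proj₁ (decompose σ')) ∧ (proj₂ (decompose σ) ≗ᵇ proj₂ (decompose σ'))) ≡ true
  decompose-cong {σ} {σ'} h = ∧-intro (==ˢ-complete (orbitShuffle-cong σ≗σ' {r} {k} e))
    (≗ᵇ-complete (λ j → trans (leftPart-cong σ≗σ' (proj₁ (decompose σ)) j) (cong (λ θ → leftPart σ' θ j) (orbitShuffle-cong σ≗σ' {r} {k} e))))
    where
    σ≗σ' : ∀ i → σ i ≡ σ' i
    σ≗σ' = ≗ᵇ-sound {f = σ} {σ'} h

  decompose-isPerm : ∀ (σ : Fin (suc n) → Fin (suc n)) → inQhatWithFcyc k σ ≡ true → isPerm (proj₂ (decompose σ)) ≡ true
  decompose-isPerm σ h = let (inj , qhat , fc) = hypotheses σ h in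
    isPerm-complete (proj₂ (decompose σ)) (Decomposition.τ-injective e σ inj qhat fc)

  assemble∘decompose : ∀ (σ : Fin (suc n) → Fin (suc n)) → inQhatWithFcyc k σ ≡ true → (uncurry assemble (decompose σ) ≗ᵇ σ) ≡ true
  assemble∘decompose σ h = let (inj , qhat , fc) = hypotheses σ h in
    ≗ᵇ-complete (Decomposition.assemble-decompose e σ inj qhat fc)

  decompose∘assemble : ∀ (b : Shuffle n r k × (Fin r → Fin r)) → isPerm (proj₂ b) ≡ true →
                       ((proj₁ (decompose (uncurry assemble b)) ==ˢ proj₁ b) ∧ (proj₂ (decompose (uncurry assemble b)) ≗ᵇ proj₂ b)) ≡ true
  decompose∘assemble (θ , τ) _ = ∧-intro (==ˢ-complete (orbitShuffle-assemble e θ τ))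
    (≗ᵇ-complete (λ j → trans (cong (λ θ′ → leftPart (assemble θ τ) θ′ j) (orbitShuffle-assemble e θ τ)) (leftPart-assemble θ τ j)))

  assemble-inQhatWithFcyc : ∀ (b : Shuffle n r k × (Fin r → Fin r)) → isPerm (proj₂ b) ≡ true → inQhatWithFcyc k (uncurry assemble b) ≡ true
  assemble-inQhatWithFcyc (θ , τ) h =
    ∧-intro (∧-intro (assemble-isPerm θ τ (isPerm-sound τ h)) (assemble-inQhat θ τ)) (≡ᵇ-complete (assemble-fcyc θ τ))

module Weights {c ℓ : Level} (R : CommutativeRing c ℓ) (x y q p : CommutativeRing.Carrier R) where
  private module R = CommutativeRing R
  open R hiding (_+_; refl; sym; trans; +-assoc; +-comm; +-identityˡ; +-identityʳ; *-identityˡ; *-identityʳ; *-assoc; *-comm)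
  open R using () renaming (_+_ to _+ᴿ_; refl to ≈-refl; sym to ≈-sym; trans to ≈-trans)
  open Sums R
  open import Relation.Binary.Reasoning.Setoid setoid
  open import Algebra.Solver.CommutativeMonoid *-commutativeMonoid using (solve; _⊜_; _⊕_) renaming (id to ε)

  infixr 8 _^_
  _^_ : Carrier → ℕ → Carrier
  _^_ = powR R

  ^-cong : ∀ a {i j} → i ≡ j → a ^ i ≈ a ^ j
  ^-cong a refl = ≈-refl

  ^-+ : ∀ a i j → a ^ (i + j) ≈ a ^ i * a ^ j
  ^-+ a zero    j = ≈-sym (R.*-identityˡ _)
  ^-+ a (suc i) j = ≈-trans (*-cong ≈-refl (^-+ a i j)) (≈-sym (R.*-assoc _ _ _))

  ^-* : ∀ a b i → (a * b) ^ i ≈ a ^ i * b ^ i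
  ^-* a b zero    = ≈-sym (R.*-identityˡ _)
  ^-* a b (suc i) = ≈-trans (*-cong ≈-refl (^-* a b i))
                            (solve 4 (λ A B C D → ((A ⊕ B) ⊕ (C ⊕ D)) ⊜ ((A ⊕ C) ⊕ (B ⊕ D))) ≈-refl a b (a ^ i) (b ^ i))

  weight : ∀ {n} → (Fin n → Fin n) → Carrier
  weight π = x ^ exc π * y ^ fix π * q ^ cyc π

  weightᵖ : ∀ {n} → (Fin (suc n) → Fin (suc n)) → Carrier
  weightᵖ σ = weight σ * p ^ fcyc σ

  weightᵖ-cong : ∀ {n} {σ σ' : Fin (suc n) → Fin (suc n)} → (∀ i → σ i ≡ σ' i) → weightᵖ σ ≈ weightᵖ σ'
  weightᵖ-cong h = *-cong (*-cong (*-cong (^-cong x (exc-cong h)) (^-cong y (fix-cong h))) (^-cong q (cyc-cong h))) (^-cong p (fcyc-cong h))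

  sumMap-weight-Perms : ∀ r → sumMap weight (Perms r) ≈ Acoef R x y q r
  sumMap-weight-Perms zero    = ≈-trans (R.+-identityʳ _) (≈-trans (R.*-identityʳ _) (R.*-identityʳ _))
  sumMap-weight-Perms (suc r) = ≈-refl

  rot-weight : ∀ k → (x * p) ^ k * y ^ fix (rot {k}) ≈ expCoef R x y p k
  rot-weight zero    = begin
    (x * p) ^ 0 * y ^ 1  ≈⟨ R.*-identityˡ _ ⟩
    y * 1#               ≈⟨ R.*-identityʳ y ⟩
    y                    ≈⟨ ≈-sym (R.+-identityˡ y) ⟩
    0# +ᴿ y              ≈⟨ +-cong (≈-sym (-‿inverseʳ 1#)) ≈-refl ⟩
    (1# - 1#) +ᴿ y       ≈⟨ R.+-assoc _ _ _ ⟩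
    1# +ᴿ (- 1# +ᴿ y)    ≈⟨ +-cong ≈-refl (R.+-comm (- 1#) y) ⟩
    1# +ᴿ (y - 1#)       ∎
  rot-weight (suc k) = ≈-trans (*-cong ≈-refl (^-cong y (fix-rot-suc k))) (R.*-identityʳ _)

  weightᵖ-assemble : ∀ {n r k} (θ : Shuffle n r k) (τ : Fin r → Fin r) → Injective _≡_ _≡_ τ →
                     weightᵖ (assemble θ τ) ≈ (p * q) * (expCoef R x y p k * weight τ)
  weightᵖ-assemble {n} {k = k} θ τ iτ = begin
    x ^ exc σ * y ^ fix σ * q ^ cyc σ * p ^ fcyc σ
      ≈⟨ *-cong (*-cong (*-cong (^-cong x (assemble-exc θ τ)) (^-cong y (assemble-fix θ τ))) (^-cong q (assemble-cyc θ τ iτ))) (^-cong p (assemble-fcyc θ τ)) ⟩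
    x ^ (exc τ + k) * y ^ (fix τ + f) * q ^ (cyc τ + 1) * p ^ suc k
      ≈⟨ *-cong (*-cong (*-cong (^-+ x (exc τ) k) (^-+ y (fix τ) f)) (^-+ q (cyc τ) 1)) ≈-refl ⟩
    (x ^ exc τ * x ^ k) * (y ^ fix τ * y ^ f) * (q ^ cyc τ * (q * 1#)) * (p * p ^ k)
      ≈⟨ solve 8 (λ X Y Q Xk Pk Yf Q₁ P₁ → ((((X ⊕ Xk) ⊕ (Y ⊕ Yf)) ⊕ (Q ⊕ (Q₁ ⊕ ε))) ⊕ (P₁ ⊕ Pk))
                                           ⊜ ((P₁ ⊕ Q₁) ⊕ (((Xk ⊕ Pk) ⊕ Yf) ⊕ ((X ⊕ Y) ⊕ Q))))
               ≈-refl (x ^ exc τ) (y ^ fix τ) (q ^ cyc τ) (x ^ k) (p ^ k) (y ^ f) q p ⟩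
    (p * q) * ((x ^ k * p ^ k) * y ^ f * weight τ)
      ≈⟨ *-cong ≈-refl (*-cong (≈-trans (*-cong (≈-sym (^-* x p k)) ≈-refl) (rot-weight k)) ≈-refl) ⟩
    (p * q) * (expCoef R x y p k * weight τ) ∎
    where
    σ : Fin (suc n) → Fin (suc n)
    σ = assemble θ τ
    f : ℕ
    f = fix (rot {k})

  sum-inQhatWithFcyc : ∀ n k → k ≤ n →
    sumMapIf (inQhatWithFcyc k) weightᵖ (allFuns (suc n) (suc n)) ≈ (p * q) * natMul R (n C k) (expCoef R x y p k * Acoef R x y q (n ∸ k))
  sum-inQhatWithFcyc n k k≤n = begin
    sumMapIf (inQhatWithFcyc k) weightᵖ (allFuns (suc n) (suc n))
      ≈⟨ sumMapIf-bijection (functions (suc n) (suc n)) (shuffles n r k ×ᴱ functions r r)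
           (inQhatWithFcyc k) (isPerm ∘ proj₂) weightᵖ (uncurry assemble) decompose
           (λ {σ} {σ'} h → weightᵖ-cong (≗ᵇ-sound {f = σ} {σ'} h))
           (λ {σ} {σ'} h → inQhatWithFcyc-cong k (≗ᵇ-sound {f = σ} {σ'} h))
           (λ {(θ , τ)} {(θ' , τ')} h → isPerm-cong (≗ᵇ-sound {f = τ} {τ'} (∧-elimʳ {θ ==ˢ θ'} h)))
           (λ {b} {b'} → assemble-cong {b} {b'}) (λ {σ} {σ'} → decompose-cong {σ} {σ'})
           decompose-isPerm assemble∘decompose decompose∘assemble assemble-inQhatWithFcyc ⟩
    sumMapIf (isPerm ∘ proj₂) (weightᵖ ∘ uncurry assemble) (concatMap (λ θ → map (θ ,_) (allFuns r r)) (allShuffles n r k))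
      ≈⟨ sumMap-concatMap _ (λ θ → map (θ ,_) (allFuns r r)) (allShuffles n r k) ⟩
    sumMap (λ θ → sumMap _ (map (θ ,_) (allFuns r r))) (allShuffles n r k)
      ≈⟨ sumMap-cong (allShuffles n r k) per-shuffle ⟩
    sumMap (λ _ → (p * q) * (E * A)) (allShuffles n r k)
      ≈⟨ sumMap-const _ (allShuffles n r k) ⟩
    natMul R (length (allShuffles n r k)) ((p * q) * (E * A))
      ≡⟨ cong (λ j → natMul R j ((p * q) * (E * A))) (length-allShuffles n r k e) ⟩
    natMul R (n C k) ((p * q) * (E * A))
      ≈⟨ natMul-*ˡ (n C k) (p * q) _ ⟩
    (p * q) * natMul R (n C k) (E * A) ∎
    where
    r : ℕ
    r = n ∸ k
    e : r + k ≡ n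
    e = m∸n+n≡m k≤n
    open Correspondence {n} {r} {k} e
    E A : Carrier
    E = expCoef R x y p k
    A = Acoef R x y q r

    per-shuffle : ∀ θ → sumMap (λ (θ , τ) → if isPerm τ then weightᵖ (assemble θ τ) else 0#) (map (θ ,_) (allFuns r r)) ≈ (p * q) * (E * A)
    per-shuffle θ = begin
      sumMap _ (map (θ ,_) (allFuns r r))                           ≡⟨ sumMap-map _ (θ ,_) (allFuns r r) ⟩
      sumMapIf isPerm (weightᵖ ∘ assemble θ) (allFuns r r)           ≈⟨ sumMapIf-cong isPerm (allFuns r r) (λ τ h → weightᵖ-assemble θ τ (isPerm-sound τ h)) ⟩
      sumMapIf isPerm (λ τ → (p * q) * (E * weight τ)) (allFuns r r) ≈⟨ sumMapIf-*ˡ isPerm (p * q) _ (allFuns r r) ⟩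
      (p * q) * sumMapIf isPerm (λ τ → E * weight τ) (allFuns r r)   ≈⟨ *-cong ≈-refl (sumMapIf-*ˡ isPerm E weight (allFuns r r)) ⟩
      (p * q) * (E * sumMapIf isPerm weight (allFuns r r))          ≈⟨ *-cong ≈-refl (*-cong ≈-refl (≈-sym (sumMap-filterB isPerm weight (allFuns r r)))) ⟩
      (p * q) * (E * sumMap weight (Perms r))                       ≈⟨ *-cong ≈-refl (*-cong ≈-refl (sumMap-weight-Perms r)) ⟩
      (p * q) * (E * A)                                             ∎

theorem3p2 : ∀ {c ℓ} (R : CommutativeRing c ℓ) (x y q p : CommutativeRing.Carrier R) (n : ℕ) →
    CommutativeRing._≈_ R (Atil R x y q p n) (rhsCoef R x y q p n)
theorem3p2 R x y q p n = begin
  sumMap weightᵖ (Qhat n)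
    ≈⟨ sumMap-filterB inQhat weightᵖ (filterB isPerm Fns) ⟩
  sumMapIf inQhat weightᵖ (filterB isPerm Fns)
    ≈⟨ sumMapIf-filterB isPerm inQhat weightᵖ Fns ⟩
  sumMapIf (λ σ → isPerm σ ∧ inQhat σ) weightᵖ Fns
    ≈⟨ sumMapIf-fibres _ (λ σ k → inQhatWithFcyc k σ) weightᵖ Fns (upTo (suc n)) countB-inQhatWithFcyc ⟩
  sumMap (λ k → sumMapIf (inQhatWithFcyc k) weightᵖ Fns) (upTo (suc n))
    ≈⟨ sumMap-cong-upTo (suc n) (λ k k<n+1 → sum-inQhatWithFcyc n k (s≤s⁻¹ k<n+1)) ⟩
  sumMap (λ k → (p * q) * summand k) (upTo (suc n))
    ≈⟨ sumMap-*ˡ (p * q) summand (upTo (suc n)) ⟩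
  (p * q) * sumMap summand (upTo (suc n)) ∎
  where
  open CommutativeRing R using (setoid; _*_)
  open import Relation.Binary.Reasoning.Setoid setoid
  open Sums R
  open Weights R x y q p
  Fns : List (Fin (suc n) → Fin (suc n))
  Fns = allFuns (suc n) (suc n)
  summand : ℕ → CommutativeRing.Carrier R
  summand k = natMul R (n C k) (expCoef R x y p k * Acoef R x y q (n ∸ k))
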